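{- Let $F_r(t,q)$ be the generating series, by half-perimeter ($t$) and area ($q$), of convex polyominoes invariant under rotation by $90^\circ$. For $m\ge1$ let $T_{0,m}(x,q)=\sum x^{\max_i \ell_i}q^{\ell_1+\cdots+\ell_m}$, the sum over all sequences $(\ell_1,\dots,\ell_m)$ of nonnegative integers that are weakly unimodal (weakly increasing up to some index, then weakly decreasing). Then $$F_r(t,q)=\sum_{m\ge1}t^{2m}q^{m^2}\,T_{0,m}(t^4,q^4).$$
   Context: A polyomino is a finite edge-connected union of unit cells of the square lattice, up to translation; it is convex if its intersection with every horizontal and every vertical line is connected. Half-perimeter is width plus height, area is the number of cells. A polyomino is invariant under a rotation if the rotation maps it to a translate of itself. -}

module Defs where

open import Data.Nat using (ℕ; zero; suc; _+_; _*_; _∸_; _≤_; _<_; _⊔_)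
open import Data.Bool using (Bool; true; false)
open import Data.Vec using (Vec; []; _∷_; lookup; replicate; foldr; sum)
open import Data.Fin using (Fin; toℕ)
open import Data.Product using (Σ; ∃; _×_; _,_)
open import Data.Sum using (_⊎_)
open import Relation.Binary.PropositionalEquality using (_≡_)

-- A polyomino, up to translation, is stored canonically inside
-- its bounding box [0,w) × [0,h): grid is a Vec of w columns, each a
-- Vec of h Booleans; cell (x , y) is filled iff the entry is true.

Grid : ℕ → ℕ → Set
Grid w h = Vec (Vec Bool h) w

nthB : ∀ {n} → Vec Bool n → ℕ → Bool
nthB []       _       = false
nthB (b ∷ bs) zero    = b
nthB (b ∷ bs) (suc k) = nthB bs k

colAt : ∀ {w h} → Grid w h → ℕ → Vec Bool h
colAt {h = h} []      _       = replicate h false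
colAt         (c ∷ g) zero    = c
colAt         (c ∷ g) (suc k) = colAt g k

cell : ∀ {w h} → Grid w h → ℕ → ℕ → Bool
cell g x y = nthB (colAt g x) y

In : ∀ {w h} → Grid w h → ℕ → ℕ → Set
In g x y = cell g x y ≡ true

Adj : ℕ × ℕ → ℕ × ℕ → Set
Adj (x , y) (x' , y') =
  (x ≡ x' × (suc y ≡ y' ⊎ suc y' ≡ y)) ⊎ (y ≡ y' × (suc x ≡ x' ⊎ suc x' ≡ x))

data Reach {w h} (g : Grid w h) : ℕ × ℕ → ℕ × ℕ → Set where
  here : ∀ {c} → Reach g c c
  step : ∀ {x y x' y' e} → Adj (x , y) (x' , y') → In g x' y' →
         Reach g (x' , y') e → Reach g (x , y) e

EdgeConnected : ∀ {w h} → Grid w h → Set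
EdgeConnected g = ∀ x y x' y' → In g x y → In g x' y' → Reach g (x , y) (x' , y')

Convex : ∀ {w h} → Grid w h → Set
Convex g =
  (∀ y x₁ x₂ x → In g x₁ y → In g x₂ y → x₁ ≤ x → x ≤ x₂ → In g x y) ×
  (∀ x y₁ y₂ y → In g x y₁ → In g x y₂ → y₁ ≤ y → y ≤ y₂ → In g x y)

-- the grid is exactly the bounding box: nonempty, every column and row meets P
TightBox : ∀ {w h} → Grid w h → Set
TightBox {w} {h} g =
  1 ≤ w × (∀ x → x < w → ∃ λ y → In g x y) × (∀ y → y < h → ∃ λ x → In g x y)

-- invariance under rotation by 90°: the rotated copy
-- {(h-1-y , x) : (x , y) ∈ P} coincides with P (translation absorbed
-- by the canonical placement in the bounding box)
Rot90Invariant : ∀ {w h} → Grid w h → Set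
Rot90Invariant {w} {h} g =
  w ≡ h × (∀ x y → x < w → y < h → cell g x y ≡ cell g (h ∸ 1 ∸ y) x)

countTrue : ∀ {n} → Vec Bool n → ℕ
countTrue []           = 0
countTrue (true  ∷ bs) = suc (countTrue bs)
countTrue (false ∷ bs) = countTrue bs

area : ∀ {w h} → Grid w h → ℕ
area []      = 0
area (c ∷ g) = countTrue c + area g

-- rotation-invariant convex polyominoes with half-perimeter n and area a
-- (proof fields irrelevant, so a polyomino is determined by its grid)
record RotConvexPoly (n a : ℕ) : Set where
  field
    width  : ℕ
    height : ℕ
    grid   : Grid width height
    .tight     : TightBox grid
    .connected : EdgeConnected grid
    .convex    : Convex grid
    .rotInv    : Rot90Invariant grid
    .halfPerim : width + height ≡ n
    .areaEq    : area grid ≡ a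

vmax : ∀ {m} → Vec ℕ m → ℕ
vmax = foldr _ _⊔_ 0

WeaklyUnimodal : ∀ {m} → Vec ℕ m → Set
WeaklyUnimodal {m} ls = ∃ λ k →
  (∀ (i j : Fin m) → toℕ i ≤ toℕ j → toℕ j ≤ k → lookup ls i ≤ lookup ls j) ×
  (∀ (i j : Fin m) → k ≤ toℕ i → toℕ i ≤ toℕ j → lookup ls j ≤ lookup ls i)

-- index set of the monomials t^n q^a in  Σ_{m≥1} t^{2m} q^{m²} T_{0,m}(t⁴,q⁴):
-- pairs (m , ℓ) with m ≥ 1, ℓ weakly unimodal of length m,
-- 2m + 4·max ℓ = n and m² + 4·Σℓ = a
record UnimodalTerm (n a : ℕ) : Set where
  field
    len  : ℕ
    seq  : Vec ℕ len
    .lenPos   : 1 ≤ len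
    .unimodal : WeaklyUnimodal seq
    .tExp     : 2 * len + 4 * vmax seq ≡ n
    .qExp     : len * len + 4 * sum seq ≡ a

-- Let P be a rotation-invariant convex polyomino in its w × w bounding box and (M , M) its
-- first diagonal cell.  In a convex polyomino a cell above the diagonal and a cell below it,
-- to its lower right, enclose a diagonal cell; together with the rotation this shows that P
-- misses the corner [0, M)², while convexity between the four rotations of (M , M) fills the
-- central square [M, w ∸ M)² of side m = w ∸ 2M ≥ 1.  Hence P is this square with four
-- congruent arms, and the left arm is determined by the lengths ℓ i of its rows M + i.  Column
-- convexity makes ℓ weakly unimodal, and max ℓ = M because P reaches column 0.  So P has
-- half-perimeter 2w = 2m + 4 max ℓ and area m² + 4 Σ ℓ, and conversely every weakly unimodal
-- ℓ of length m ≥ 1 is the arm profile of exactly one such polyomino.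

module Submission where

open import Data.Bool using (Bool; true; false; _∧_; _∨_; if_then_else_)
open import Data.Bool.Properties using (∧-zeroʳ; ¬-not; T-≡) renaming (_≟_ to _≟ᵇ_)
open import Data.Empty using (⊥; ⊥-elim)
open import Data.Fin using (Fin; toℕ; fromℕ<)
open import Data.Fin.Properties using (toℕ<n; toℕ-fromℕ<)
open import Data.Nat
open import Data.Nat.Properties
open import Data.Nat.Tactic.RingSolver using (solve-∀)
open import Data.Product using (∃; _×_; _,_; proj₁; proj₂)
open import Data.Sum using (_⊎_; inj₁; inj₂)
open import Data.Vec using (Vec; []; _∷_; lookup; replicate; sum)
open import Function.Bundles using (_↔_; mk↔ₛ′; Equivalence)
open import Relation.Binary.PropositionalEquality
open import Relation.Nullary using (¬_; yes; no)
open import Relation.Nullary.Decidable using (recompute)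
open import Defs

true≢false : true ≡ false → ⊥
true≢false ()

≡true-ext : ∀ {a b} → (a ≡ true → b ≡ true) → (b ≡ true → a ≡ true) → a ≡ b
≡true-ext {true}  {true}  f g = refl
≡true-ext {true}  {false} f g = sym (f refl)
≡true-ext {false} {true}  f g = g refl
≡true-ext {false} {false} f g = refl

∧-≡true⁻ : ∀ {a b} → a ∧ b ≡ true → a ≡ true × b ≡ true
∧-≡true⁻ {true} {true} _ = refl , refl

∧-≡true : ∀ {a b} → a ≡ true → b ≡ true → a ∧ b ≡ true
∧-≡true refl refl = refl

∨-≡true⁻ : ∀ {a b} → a ∨ b ≡ true → a ≡ true ⊎ b ≡ true
∨-≡true⁻ {true}  _ = inj₁ refl
∨-≡true⁻ {false} e = inj₂ e

∨-≡trueˡ : ∀ {a} b → a ≡ true → a ∨ b ≡ true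
∨-≡trueˡ b refl = refl

∨-≡trueʳ : ∀ a {b} → b ≡ true → a ∨ b ≡ true
∨-≡trueʳ true  _ = refl
∨-≡trueʳ false e = e

inRange : ℕ → ℕ → ℕ → Bool
inRange lo hi y = (lo ≤ᵇ y) ∧ (y <ᵇ hi)

inRange⁻ : ∀ {lo hi y} → inRange lo hi y ≡ true → lo ≤ y × y < hi
inRange⁻ {lo} {hi} {y} e with ∧-≡true⁻ {lo ≤ᵇ y} e
... | l , r = ≤ᵇ⇒≤ lo y (Equivalence.from T-≡ l) , <ᵇ⇒< y hi (Equivalence.from T-≡ r)

inRange⁺ : ∀ {lo hi y} → lo ≤ y → y < hi → inRange lo hi y ≡ true
inRange⁺ lo≤y y<hi = ∧-≡true (Equivalence.to T-≡ (≤⇒≤ᵇ lo≤y)) (Equivalence.to T-≡ (<⇒<ᵇ y<hi))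

inRange-suc : ∀ lo hi y → inRange (suc lo) (suc hi) (suc y) ≡ inRange lo hi y
inRange-suc zero    hi y = refl
inRange-suc (suc lo) hi y = refl

-- Finite sums over an initial segment of ℕ

𝟙 : Bool → ℕ
𝟙 true  = 1
𝟙 false = 0

𝟙≤1 : ∀ b → 𝟙 b ≤ 1
𝟙≤1 true  = ≤-refl
𝟙≤1 false = z≤n

𝟙-∨+∧ : ∀ a b → 𝟙 (a ∨ b) + 𝟙 (a ∧ b) ≡ 𝟙 a + 𝟙 b
𝟙-∨+∧ true  true  = refl
𝟙-∨+∧ true  false = refl
𝟙-∨+∧ false true  = refl
𝟙-∨+∧ false false = refl

∑< : ℕ → (ℕ → ℕ) → ℕ
∑< zero    f = 0
∑< (suc n) f = f 0 + ∑< n (λ i → f (suc i))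

syntax ∑< n (λ i → e) = ∑[ i < n ] e

∑-cong : ∀ n f g → (∀ i → i < n → f i ≡ g i) → ∑< n f ≡ ∑< n g
∑-cong zero    f g f≗g = refl
∑-cong (suc n) f g f≗g =
  cong₂ _+_ (f≗g 0 z<s) (∑-cong n _ _ (λ i i<n → f≗g (suc i) (s<s i<n)))

∑-const : ∀ n c → ∑[ i < n ] c ≡ n * c
∑-const zero    c = refl
∑-const (suc n) c = cong (c +_) (∑-const n c)

∑-zero : ∀ n f → (∀ i → i < n → f i ≡ 0) → ∑< n f ≡ 0
∑-zero n f f≗0 = trans (∑-cong n f (λ _ → 0) f≗0) (trans (∑-const n 0) (*-zeroʳ n))

∑-distrib-+ : ∀ n f g → ∑[ i < n ] (f i + g i) ≡ ∑< n f + ∑< n g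
∑-distrib-+ zero    f g = refl
∑-distrib-+ (suc n) f g
  rewrite ∑-distrib-+ n (λ i → f (suc i)) (λ i → g (suc i)) =
    interchange (f 0) (g 0) (∑< n (λ i → f (suc i))) (∑< n (λ i → g (suc i)))
  where interchange : ∀ a b c d → a + b + (c + d) ≡ a + c + (b + d)
        interchange = solve-∀

∑-comm : ∀ n k (f : ℕ → ℕ → ℕ) → ∑[ x < n ] ∑[ y < k ] f x y ≡ ∑[ y < k ] ∑[ x < n ] f x y
∑-comm zero    k f = sym (∑-zero k _ (λ _ _ → refl))
∑-comm (suc n) k f =
  trans (cong (∑< k (f 0) +_) (∑-comm n k (λ x → f (suc x))))
        (sym (∑-distrib-+ k (f 0) (λ y → ∑[ x < n ] f (suc x) y)))

∑-last : ∀ n f → ∑< (suc n) f ≡ ∑< n f + f n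
∑-last zero    f = +-comm (f 0) 0
∑-last (suc n) f rewrite ∑-last n (λ i → f (suc i)) = sym (+-assoc (f 0) _ _)

∑-reverse : ∀ n f → ∑[ i < n ] f (n ∸ suc i) ≡ ∑< n f
∑-reverse zero    f = refl
∑-reverse (suc n) f =
  trans (cong (f n +_) (∑-reverse n f)) (trans (+-comm (f n) _) (sym (∑-last n f)))

∑-inRange : ∀ M k n (G : ℕ → ℕ) → M + k ≤ n →
            ∑[ x < n ] (𝟙 (inRange M (M + k) x) * G (x ∸ M)) ≡ ∑< k G
∑-inRange zero zero n G _ = ∑-zero n _ (λ _ _ → refl)
∑-inRange zero (suc k) (suc n) G (s≤s k≤n) =
  cong₂ _+_ (+-identityʳ (G 0)) (∑-inRange zero k n (λ x → G (suc x)) k≤n)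
∑-inRange (suc M) k (suc n) G (s≤s M+k≤n) =
  trans (∑-cong n _ _ (λ x _ → cong (λ b → 𝟙 b * G (x ∸ M)) (inRange-suc M (M + k) x)))
        (∑-inRange M k n G M+k≤n)

count : ℕ → (ℕ → Bool) → ℕ
count n f = ∑[ i < n ] 𝟙 (f i)

count≤ : ∀ n f → count n f ≤ n
count≤ zero    f = z≤n
count≤ (suc n) f = +-mono-≤ (𝟙≤1 (f 0)) (count≤ n (λ i → f (suc i)))

count-all : ∀ n f → (∀ i → i < n → f i ≡ true) → count n f ≡ n
count-all zero    f all = refl
count-all (suc n) f all rewrite all 0 z<s =
  cong suc (count-all n (λ i → f (suc i)) (λ i i<n → all (suc i) (s<s i<n)))

count-inRange : ∀ n lo hi → hi ≤ n → count n (inRange lo hi) ≡ hi ∸ lo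
count-inRange zero    zero     zero    _ = refl
count-inRange zero    (suc lo) zero    _ = refl
count-inRange (suc n) zero     zero    _ = ∑-zero (suc n) _ (λ y _ → cong 𝟙 (∧-zeroʳ (0 ≤ᵇ y)))
count-inRange (suc n) (suc lo) zero    _ = ∑-zero (suc n) _ (λ y _ → cong 𝟙 (∧-zeroʳ (suc lo ≤ᵇ y)))
count-inRange (suc n) zero     (suc hi) (s≤s hi≤n) = cong suc (count-inRange n zero hi hi≤n)
count-inRange (suc n) (suc lo) (suc hi) (s≤s hi≤n) =
  trans (∑-cong n _ _ (λ y _ → cong 𝟙 (inRange-suc lo hi y))) (count-inRange n lo hi hi≤n)

UpClosed : ℕ → (ℕ → Bool) → Set
UpClosed n f = ∀ x x' → x ≤ x' → x' < n → f x ≡ true → f x' ≡ true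

upClosed-threshold : ∀ n f → UpClosed n f → ∀ x → x < n →
  (f x ≡ true → n ≤ x + count n f) × (n ≤ x + count n f → f x ≡ true)
upClosed-threshold (suc n) f up x x<n with f 0 in f0
... | true = (λ _ → subst (λ c → suc n ≤ x + suc c) (sym allTail) (m≤n+m (suc n) x)) ,
             (λ _ → up 0 x z≤n x<n f0)
  where allTail : count n (λ i → f (suc i)) ≡ n
        allTail = count-all n (λ i → f (suc i)) (λ i i<n → up 0 (suc i) z≤n (s<s i<n) f0)
... | false with x
... | zero   = (λ f0≡true → ⊥-elim (true≢false (trans (sym f0≡true) f0))) ,
               (λ n<count → ⊥-elim (<⇒≱ (s≤s (count≤ n (λ i → f (suc i)))) n<count))
... | suc x' = (λ fx → s≤s (proj₁ tail fx)) , (λ le → proj₂ tail (s≤s⁻¹ le))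
  where tail : (f (suc x') ≡ true → n ≤ x' + count n (λ i → f (suc i))) ×
               (n ≤ x' + count n (λ i → f (suc i)) → f (suc x') ≡ true)
        tail = upClosed-threshold n (λ i → f (suc i))
                 (λ a b a≤b b<n → up (suc a) (suc b) (s≤s a≤b) (s<s b<n)) x' (s<s⁻¹ x<n)

firstTrue : ℕ → (ℕ → Bool) → ℕ
firstTrue zero    f = 0
firstTrue (suc n) f = if f 0 then 0 else suc (firstTrue n (λ i → f (suc i)))

firstTrue-minimal : ∀ n f j → j < firstTrue n f → f j ≡ false
firstTrue-minimal (suc n) f j j< with f 0 in f0
firstTrue-minimal (suc n) f zero    j< | false = f0
firstTrue-minimal (suc n) f (suc j) j< | false =
  firstTrue-minimal n (λ i → f (suc i)) j (s<s⁻¹ j<)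

firstTrue-true : ∀ n f k → k < n → f k ≡ true → f (firstTrue n f) ≡ true × firstTrue n f ≤ k
firstTrue-true (suc n) f k k<n fk with f 0 in f0
... | true = f0 , z≤n
firstTrue-true (suc n) f zero    k<n fk | false = ⊥-elim (true≢false (trans (sym fk) f0))
firstTrue-true (suc n) f (suc k) k<n fk | false
  with firstTrue-true n (λ i → f (suc i)) k (s<s⁻¹ k<n) fk
... | found , ≤k = found , s≤s ≤k

firstTrue-unique : ∀ n f k → k < n → f k ≡ true → (∀ j → j < k → f j ≡ false) → firstTrue n f ≡ k
firstTrue-unique n f k k<n fk before with firstTrue-true n f k k<n fk
... | found , ≤k with m≤n⇒m<n∨m≡n ≤k
... | inj₂ eq = eq
... | inj₁ lt = ⊥-elim (true≢false (trans (sym found) (before _ lt)))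

-- Reflection of the coordinate range [0, w)

mirror : ℕ → ℕ → ℕ
mirror w y = w ∸ 1 ∸ y

mirror< : ∀ w y → y < w → mirror w y < w
mirror< (suc w) y _ = s≤s (m∸n≤m w y)

mirror-involutive : ∀ w y → y < w → mirror w (mirror w y) ≡ y
mirror-involutive (suc w) y (s≤s y≤w) = m∸[m∸n]≡n y≤w

suc[y+mirror]≡w : ∀ w y → y < w → suc (y + mirror w y) ≡ w
suc[y+mirror]≡w (suc w) y (s≤s y≤w) = cong suc (m+[n∸m]≡n y≤w)

+<⇒≤mirror : ∀ w x y → x + y < w → x ≤ mirror w y
+<⇒≤mirror (suc w) x y (s≤s x+y≤w) = m+n≤o⇒m≤o∸n x x+y≤w

m∸n≤o⇒m≤n+o : ∀ m n o → m ∸ n ≤ o → m ≤ n + o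
m∸n≤o⇒m≤n+o m n o le = ≤-trans (m≤n+m∸n m n) (+-monoʳ-≤ n le)

m∸n≤o⇒m≤o+n : ∀ m n o → m ∸ n ≤ o → m ≤ o + n
m∸n≤o⇒m≤o+n m n o le = subst (m ≤_) (+-comm n o) (m∸n≤o⇒m≤n+o m n o le)

m≤o+n⇒m∸n≤o : ∀ m n o → m ≤ o + n → m ∸ n ≤ o
m≤o+n⇒m∸n≤o m n o le = m≤n+o⇒m∸n≤o m n (subst (m ≤_) (+-comm o n) le)

reverse< : ∀ m i → i < m → m ∸ suc i < m
reverse< (suc m) i _ = s≤s (m∸n≤m m i)

reverse-involutive : ∀ m i → i < m → m ∸ suc (m ∸ suc i) ≡ i
reverse-involutive (suc m) i (s≤s i≤m) = m∸[m∸n]≡n i≤m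

offset< : ∀ M m y → M ≤ y → y < M + m → y ∸ M < m
offset< M m y M≤y y<M+m = +-cancelˡ-< M (y ∸ M) m (subst (_< M + m) (sym (m+[n∸m]≡n M≤y)) y<M+m)

-- In a box of side M + m + M, y and y' are mirror images when suc (y + y') ≡ M + m + M.

mirrored-≤⇒< : ∀ M m y y' c → suc (y + y') ≡ M + m + M → M ≤ y + c → y' < M + m + c
mirrored-≤⇒< M m y y' c mir M≤y+c = +-cancelʳ-≤ M (suc y') (M + m + c) (begin
  suc y' + M        ≤⟨ +-monoʳ-≤ (suc y') M≤y+c ⟩
  suc y' + (y + c)  ≡⟨ shuffle₁ y y' c ⟩
  suc (y + y') + c  ≡⟨ cong (_+ c) mir ⟩
  M + m + M + c     ≡⟨ shuffle₂ M m c ⟩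
  M + m + c + M     ∎)
  where open ≤-Reasoning
        shuffle₁ : ∀ y y' c → suc y' + (y + c) ≡ suc (y + y') + c
        shuffle₁ = solve-∀
        shuffle₂ : ∀ M m c → M + m + M + c ≡ M + m + c + M
        shuffle₂ = solve-∀

mirrored-<⇒≤ : ∀ M m y y' c → suc (y + y') ≡ M + m + M → y' < M + m + c → M ≤ y + c
mirrored-<⇒≤ M m y y' c mir y'< = +-cancelʳ-≤ (M + m) M (y + c) (begin
  M + (M + m)      ≡⟨ shuffle₁ M m ⟩
  M + m + M        ≡⟨ sym mir ⟩
  suc (y + y')     ≡⟨ sym (+-suc y y') ⟩
  y + suc y'       ≤⟨ +-monoʳ-≤ y y'< ⟩
  y + (M + m + c)  ≡⟨ shuffle₂ y M m c ⟩
  y + c + (M + m)  ∎)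
  where open ≤-Reasoning
        shuffle₁ : ∀ M m → M + (M + m) ≡ M + m + M
        shuffle₁ = solve-∀
        shuffle₂ : ∀ y M m c → y + (M + m + c) ≡ y + c + (M + m)
        shuffle₂ = solve-∀

mirrored-sym : ∀ {w} y y' → suc (y + y') ≡ w → suc (y' + y) ≡ w
mirrored-sym y y' mir = trans (cong suc (+-comm y' y)) mir

mirrored-offset : ∀ M m y y' → suc (y + y') ≡ M + m + M → M ≤ y → y < M + m →
                  y' ∸ M ≡ m ∸ suc (y ∸ M)
mirrored-offset M m y y' mir M≤y y<M+m = trans (cong (_∸ M) y'≡) (m+n∸m≡n M _)
  where
  j : ℕ
  j = y ∸ M
  y≡ : y ≡ M + j
  y≡ = sym (m+[n∸m]≡n M≤y)
  j<m : j < m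
  j<m = offset< M m y M≤y y<M+m
  y'≡ : y' ≡ M + (m ∸ suc j)
  y'≡ = +-cancelˡ-≡ (suc y) y' (M + (m ∸ suc j)) (begin
    suc (y + y')                  ≡⟨ mir ⟩
    M + m + M                     ≡⟨ cong (λ z → M + z + M) (sym (m+[n∸m]≡n j<m)) ⟩
    M + (suc j + (m ∸ suc j)) + M ≡⟨ shuffle M j (m ∸ suc j) ⟩
    suc (M + j) + (M + (m ∸ suc j)) ≡⟨ cong (λ z → suc z + (M + (m ∸ suc j))) (sym y≡) ⟩
    suc y + (M + (m ∸ suc j))     ∎)
    where open ≡-Reasoning
          shuffle : ∀ M j k → M + (suc j + k) + M ≡ suc (M + j) + (M + k)
          shuffle = solve-∀

at : ∀ {m} → Vec ℕ m → ℕ → ℕ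
at []      _       = 0
at (x ∷ v) zero    = x
at (x ∷ v) (suc i) = at v i

tabulateℕ : (m : ℕ) → (ℕ → ℕ) → Vec ℕ m
tabulateℕ zero    f = []
tabulateℕ (suc m) f = f 0 ∷ tabulateℕ m (λ i → f (suc i))

at-tabulateℕ : ∀ m f i → i < m → at (tabulateℕ m f) i ≡ f i
at-tabulateℕ (suc m) f zero    _   = refl
at-tabulateℕ (suc m) f (suc i) i<m = at-tabulateℕ m (λ i → f (suc i)) i (s<s⁻¹ i<m)

lookup≡at : ∀ {m} (v : Vec ℕ m) (i : Fin m) → lookup v i ≡ at v (toℕ i)
lookup≡at (x ∷ v) Fin.zero    = refl
lookup≡at (x ∷ v) (Fin.suc i) = lookup≡at v i

lookup-fromℕ< : ∀ {m} (v : Vec ℕ m) i (i<m : i < m) → lookup v (fromℕ< i<m) ≡ at v i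
lookup-fromℕ< v i i<m = trans (lookup≡at v (fromℕ< i<m)) (cong (at v) (toℕ-fromℕ< i<m))

sum≡∑at : ∀ {m} (v : Vec ℕ m) → sum v ≡ ∑< m (at v)
sum≡∑at []      = refl
sum≡∑at (x ∷ v) = cong (x +_) (sum≡∑at v)

at-ext : ∀ {m} (u v : Vec ℕ m) → (∀ i → i < m → at u i ≡ at v i) → u ≡ v
at-ext []      []      _   = refl
at-ext (x ∷ u) (y ∷ v) u≗v = cong₂ _∷_ (u≗v 0 z<s) (at-ext u v (λ i i<m → u≗v (suc i) (s<s i<m)))

at≤vmax : ∀ {m} (v : Vec ℕ m) i → at v i ≤ vmax v
at≤vmax []      i       = z≤n
at≤vmax (x ∷ v) zero    = m≤m⊔n x (vmax v)
at≤vmax (x ∷ v) (suc i) = ≤-trans (at≤vmax v i) (m≤n⊔m x (vmax v))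

vmax≤ : ∀ {m} (v : Vec ℕ m) B → (∀ i → i < m → at v i ≤ B) → vmax v ≤ B
vmax≤ []      B bound = z≤n
vmax≤ (x ∷ v) B bound = ⊔-lub (bound 0 z<s) (vmax≤ v B (λ i i<m → bound (suc i) (s<s i<m)))

vmax-attained : ∀ {m} (v : Vec ℕ m) → 1 ≤ m → ∃ λ i → i < m × at v i ≡ vmax v
vmax-attained (x ∷ [])    _ = 0 , z<s , sym (⊔-identityʳ x)
vmax-attained (x ∷ y ∷ v) _ with vmax-attained (y ∷ v) (s≤s z≤n) | x ≤? vmax (y ∷ v)
... | i , i<m , eq | yes x≤ = suc i , s<s i<m , trans eq (sym (m≤n⇒m⊔n≡n x≤))
... | i , i<m , eq | no  x≰ = 0 , z<s , sym (m≥n⇒m⊔n≡m (<⇒≤ (≰⇒> x≰)))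

vmax-unique : ∀ {m} (v : Vec ℕ m) B → (∀ i → i < m → at v i ≤ B) → (∃ λ i → i < m × at v i ≡ B) →
              vmax v ≡ B
vmax-unique v B bound (i , i<m , eq) =
  ≤-antisym (vmax≤ v B bound) (≤-trans (≤-reflexive (sym eq)) (at≤vmax v i))

Quasiconcave : (ℕ → ℕ) → ℕ → Set
Quasiconcave f m = ∀ i j k c → i ≤ j → j ≤ k → k < m → c ≤ f i → c ≤ f k → c ≤ f j

quasiconcave-reverse : ∀ f m → Quasiconcave f m → Quasiconcave (λ i → f (m ∸ suc i)) m
quasiconcave-reverse f m qc i j k c i≤j j≤k k<m c≤fi c≤fk =
  qc (m ∸ suc k) (m ∸ suc j) (m ∸ suc i) c (∸-monoʳ-≤ m (s≤s j≤k)) (∸-monoʳ-≤ m (s≤s i≤j))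
     (reverse< m i (≤-<-trans i≤j (≤-<-trans j≤k k<m))) c≤fk c≤fi

weaklyUnimodal⇒quasiconcave : ∀ {m} (v : Vec ℕ m) → WeaklyUnimodal v → Quasiconcave (at v) m
weaklyUnimodal⇒quasiconcave {m} v (p , up , down) i j k c i≤j j≤k k<m c≤vi c≤vk with j ≤? p
... | yes j≤p = ≤-trans c≤vi (subst₂ _≤_ (lookup-fromℕ< v i i<m) (lookup-fromℕ< v j j<m)
      (up (fromℕ< i<m) (fromℕ< j<m) (subst₂ _≤_ (sym (toℕ-fromℕ< i<m)) (sym (toℕ-fromℕ< j<m)) i≤j)
          (subst (_≤ p) (sym (toℕ-fromℕ< j<m)) j≤p)))
  where j<m : j < m
        j<m = ≤-<-trans j≤k k<m
        i<m : i < m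
        i<m = ≤-<-trans i≤j j<m
... | no j≰p = ≤-trans c≤vk (subst₂ _≤_ (lookup-fromℕ< v k k<m) (lookup-fromℕ< v j j<m)
      (down (fromℕ< j<m) (fromℕ< k<m) (subst (p ≤_) (sym (toℕ-fromℕ< j<m)) (<⇒≤ (≰⇒> j≰p)))
            (subst₂ _≤_ (sym (toℕ-fromℕ< j<m)) (sym (toℕ-fromℕ< k<m)) j≤k)))
  where j<m : j < m
        j<m = ≤-<-trans j≤k k<m

quasiconcave⇒weaklyUnimodal : ∀ {m} (v : Vec ℕ m) → Quasiconcave (at v) m → 1 ≤ m → WeaklyUnimodal v
quasiconcave⇒weaklyUnimodal {m} v qc 1≤m = p , up , down
  where
  peak : ∃ λ i → i < m × at v i ≡ vmax v
  peak = vmax-attained v 1≤m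
  p : ℕ
  p = proj₁ peak
  p<m : p < m
  p<m = proj₁ (proj₂ peak)
  ≤peak : ∀ i → at v i ≤ at v p
  ≤peak i = ≤-trans (at≤vmax v i) (≤-reflexive (sym (proj₂ (proj₂ peak))))
  up : ∀ (i j : Fin m) → toℕ i ≤ toℕ j → toℕ j ≤ p → lookup v i ≤ lookup v j
  up i j i≤j j≤p = subst₂ _≤_ (sym (lookup≡at v i)) (sym (lookup≡at v j))
    (qc (toℕ i) (toℕ j) p (at v (toℕ i)) i≤j j≤p p<m ≤-refl (≤peak (toℕ i)))
  down : ∀ (i j : Fin m) → p ≤ toℕ i → toℕ i ≤ toℕ j → lookup v j ≤ lookup v i
  down i j p≤i i≤j = subst₂ _≤_ (sym (lookup≡at v j)) (sym (lookup≡at v i))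
    (qc p (toℕ i) (toℕ j) (at v (toℕ j)) p≤i i≤j (toℕ<n j) (≤peak (toℕ j)) ≤-refl)

tabulateColumn : (h : ℕ) → (ℕ → Bool) → Vec Bool h
tabulateColumn zero    c = []
tabulateColumn (suc h) c = c 0 ∷ tabulateColumn h (λ y → c (suc y))

tabulateGrid : (w h : ℕ) → (ℕ → ℕ → Bool) → Grid w h
tabulateGrid zero    h f = []
tabulateGrid (suc w) h f = tabulateColumn h (f 0) ∷ tabulateGrid w h (λ x → f (suc x))

nthB-tabulateColumn : ∀ h c y → y < h → nthB (tabulateColumn h c) y ≡ c y
nthB-tabulateColumn (suc h) c zero    _   = refl
nthB-tabulateColumn (suc h) c (suc y) y<h = nthB-tabulateColumn h (λ y → c (suc y)) y (s<s⁻¹ y<h)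

cell-tabulateGrid : ∀ w h f x y → x < w → y < h → cell (tabulateGrid w h f) x y ≡ f x y
cell-tabulateGrid (suc w) h f zero    y _   y<h = nthB-tabulateColumn h (f 0) y y<h
cell-tabulateGrid (suc w) h f (suc x) y x<w y<h =
  cell-tabulateGrid w h (λ x → f (suc x)) x y (s<s⁻¹ x<w) y<h

nthB⇒< : ∀ {n} (c : Vec Bool n) y → nthB c y ≡ true → y < n
nthB⇒< (b ∷ c) zero    _ = z<s
nthB⇒< (b ∷ c) (suc y) e = s<s (nthB⇒< c y e)

nthB-replicate : ∀ h y → nthB (replicate h false) y ≡ false
nthB-replicate zero    y       = refl
nthB-replicate (suc h) zero    = refl
nthB-replicate (suc h) (suc y) = nthB-replicate h y

In⇒inBox : ∀ {w h} (g : Grid w h) x y → In g x y → x < w × y < h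
In⇒inBox {h = h} []      x       y e = ⊥-elim (true≢false (trans (sym e) (nthB-replicate h y)))
In⇒inBox         (c ∷ g) zero    y e = z<s , nthB⇒< c y e
In⇒inBox         (c ∷ g) (suc x) y e with In⇒inBox g x y e
... | x<w , y<h = s<s x<w , y<h

countTrue≡count : ∀ {n} (c : Vec Bool n) → countTrue c ≡ count n (nthB c)
countTrue≡count []          = refl
countTrue≡count (true  ∷ c) = cong suc (countTrue≡count c)
countTrue≡count (false ∷ c) = countTrue≡count c

area≡∑cells : ∀ {w h} (g : Grid w h) → area g ≡ ∑[ x < w ] ∑[ y < h ] 𝟙 (cell g x y)
area≡∑cells []      = refl
area≡∑cells (c ∷ g) = cong₂ _+_ (countTrue≡count c) (area≡∑cells g)

nthB-ext : ∀ {n} (c c' : Vec Bool n) → (∀ y → y < n → nthB c y ≡ nthB c' y) → c ≡ c'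
nthB-ext []      []        _    = refl
nthB-ext (b ∷ c) (b' ∷ c') c≗c' = cong₂ _∷_ (c≗c' 0 z<s) (nthB-ext c c' (λ y y<n → c≗c' (suc y) (s<s y<n)))

cell-ext : ∀ {w h} (g g' : Grid w h) → (∀ x y → x < w → y < h → cell g x y ≡ cell g' x y) → g ≡ g'
cell-ext []      []        _    = refl
cell-ext (c ∷ g) (c' ∷ g') g≗g' =
  cong₂ _∷_ (nthB-ext c c' (λ y y<h → g≗g' 0 y z<s y<h))
            (cell-ext g g' (λ x y x<w y<h → g≗g' (suc x) y (s<s x<w) y<h))

module _ {w h} (g : Grid w h) where

  Reach-trans : ∀ {p q r} → Reach g p q → Reach g q r → Reach g p r
  Reach-trans here              q = q
  Reach-trans (step adj inP p) q = step adj inP (Reach-trans p q)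

  Reach-vertical : ∀ x y₁ y₂ → y₁ ≤ y₂ → (∀ y → y₁ ≤ y → y ≤ y₂ → In g x y) →
                   Reach g (x , y₁) (x , y₂) × Reach g (x , y₂) (x , y₁)
  Reach-vertical x y₁ zero z≤n full = here , here
  Reach-vertical x y₁ (suc y₂) y₁≤ full with m≤n⇒m<n∨m≡n y₁≤
  ... | inj₂ refl = here , here
  ... | inj₁ y₁≤y₂ with Reach-vertical x y₁ y₂ (s≤s⁻¹ y₁≤y₂) (λ y a b → full y a (m≤n⇒m≤1+n b))
  ... | up , down =
    Reach-trans up (step (inj₁ (refl , inj₁ refl)) (full (suc y₂) (<⇒≤ y₁≤y₂) ≤-refl) here) ,
    step (inj₁ (refl , inj₂ refl)) (full y₂ (s≤s⁻¹ y₁≤y₂) (n≤1+n y₂)) down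

  Reach-horizontal : ∀ y x₁ x₂ → x₁ ≤ x₂ → (∀ x → x₁ ≤ x → x ≤ x₂ → In g x y) →
                     Reach g (x₁ , y) (x₂ , y) × Reach g (x₂ , y) (x₁ , y)
  Reach-horizontal y x₁ zero z≤n full = here , here
  Reach-horizontal y x₁ (suc x₂) x₁≤ full with m≤n⇒m<n∨m≡n x₁≤
  ... | inj₂ refl = here , here
  ... | inj₁ x₁≤x₂ with Reach-horizontal y x₁ x₂ (s≤s⁻¹ x₁≤x₂) (λ x a b → full x a (m≤n⇒m≤1+n b))
  ... | right , left =
    Reach-trans right (step (inj₂ (refl , inj₁ refl)) (full (suc x₂) (<⇒≤ x₁≤x₂) ≤-refl) here) ,
    step (inj₂ (refl , inj₂ refl)) (full x₂ (s≤s⁻¹ x₁≤x₂) (n≤1+n x₂)) left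

  Reach-inColumn : ∀ x lo hi ya yb → (∀ y → lo ≤ y → y < hi → In g x y) →
                  lo ≤ ya → ya < hi → lo ≤ yb → yb < hi → Reach g (x , ya) (x , yb)
  Reach-inColumn x lo hi ya yb full lo≤ya ya< lo≤yb yb< with ≤-total ya yb
  ... | inj₁ ya≤yb = proj₁ (Reach-vertical x ya yb ya≤yb (λ y p q → full y (≤-trans lo≤ya p) (≤-<-trans q yb<)))
  ... | inj₂ yb≤ya = proj₂ (Reach-vertical x yb ya yb≤ya (λ y p q → full y (≤-trans lo≤yb p) (≤-<-trans q ya<)))

  Reach-inRow : ∀ y lo hi xa xb → (∀ x → lo ≤ x → x < hi → In g x y) →
               lo ≤ xa → xa < hi → lo ≤ xb → xb < hi → Reach g (xa , y) (xb , y)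
  Reach-inRow y lo hi xa xb full lo≤xa xa< lo≤xb xb< with ≤-total xa xb
  ... | inj₁ xa≤xb = proj₁ (Reach-horizontal y xa xb xa≤xb (λ x p q → full x (≤-trans lo≤xa p) (≤-<-trans q xb<)))
  ... | inj₂ xb≤xa = proj₂ (Reach-horizontal y xb xa xb≤xa (λ x p q → full x (≤-trans lo≤xb p) (≤-<-trans q xa<)))

  Reach-crossesColumn : ∀ {a b c d} k → In g a b → Reach g (a , b) (c , d) → a ≤ k → k < c →
                        ∃ λ r → In g k r × In g (suc k) r
  Reach-crossesColumn k ab here a≤k k<c = ⊥-elim (<⇒≱ k<c a≤k)
  Reach-crossesColumn {a} {b} k ab (step {x' = x'} adj x'y' path) a≤k k<c with x' ≤? k
  ... | yes x'≤k = Reach-crossesColumn k x'y' path x'≤k k<c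
  ... | no x'≰k with adj
  ... | inj₁ (refl , _)          = ⊥-elim (x'≰k a≤k)
  ... | inj₂ (refl , inj₂ refl) = ⊥-elim (x'≰k (≤-trans (n≤1+n x') a≤k))
  ... | inj₂ (refl , inj₁ refl) with ≤-antisym a≤k (s≤s⁻¹ (≰⇒> x'≰k))
  ... | refl = b , ab , x'y'

-- Rotation permutes the nine blocks of [0, M + m + M)² cut out by the lines M and M + m.

module _ (M m : ℕ) where

  private
    w : ℕ
    w = M + m + M

  mirror-low : ∀ y → y < w → y < M → M + m ≤ mirror w y
  mirror-low y y<w y<M = ≮⇒≥ λ y'< → <⇒≱ y<M (subst (M ≤_) (+-identityʳ y)
    (mirrored-<⇒≤ M m y (mirror w y) 0 (suc[y+mirror]≡w w y y<w)
      (subst (mirror w y <_) (sym (+-identityʳ (M + m))) y'<)))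

  mirror-high : ∀ y → y < w → M + m ≤ y → mirror w y < M
  mirror-high y y<w M+m≤y = ≰⇒> λ M≤y' → <⇒≱ (subst (y <_) (+-identityʳ (M + m))
    (mirrored-≤⇒< M m (mirror w y) y 0 (mirrored-sym y _ (suc[y+mirror]≡w w y y<w))
      (subst (M ≤_) (sym (+-identityʳ _)) M≤y'))) M+m≤y

  mirror-mid< : ∀ y → y < w → M ≤ y → mirror w y < M + m
  mirror-mid< y y<w M≤y = subst (mirror w y <_) (+-identityʳ (M + m))
    (mirrored-≤⇒< M m y (mirror w y) 0 (suc[y+mirror]≡w w y y<w) (subst (M ≤_) (sym (+-identityʳ y)) M≤y))

  mirror-mid≥ : ∀ y → y < w → y < M + m → M ≤ mirror w y
  mirror-mid≥ y y<w y< = subst (M ≤_) (+-identityʳ _)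
    (mirrored-<⇒≤ M m (mirror w y) y 0 (mirrored-sym y _ (suc[y+mirror]≡w w y y<w))
      (subst (y <_) (sym (+-identityʳ (M + m))) y<))

  RotInvariant : (ℕ → ℕ → Bool) → Set
  RotInvariant F = ∀ x y → x < w → y < w → F x y ≡ F (mirror w y) x

  -- The three given blocks meet every orbit of the rotation.
  rotInvariant-agree : ∀ Q S → RotInvariant Q → RotInvariant S →
    (∀ x y → x < M → y < M → Q x y ≡ S x y) →
    (∀ x y → x < M → M ≤ y → y < M + m → Q x y ≡ S x y) →
    (∀ x y → M ≤ x → x < M + m → M ≤ y → y < M + m → Q x y ≡ S x y) →
    ∀ x y → x < w → y < w → Q x y ≡ S x y
  rotInvariant-agree Q S Qrot Srot corner left centre = agree
    where
    rotate : ∀ x y → x < w → y < w → Q (mirror w y) x ≡ S (mirror w y) x → Q x y ≡ S x y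
    rotate x y x< y< e = trans (Qrot x y x< y<) (trans e (sym (Srot x y x< y<)))
    low<w : ∀ {y} → y < M → y < w
    low<w y<M = <-≤-trans y<M (m≤n+m M (M + m))
    mid<w : ∀ {y} → y < M + m → y < w
    mid<w y< = <-≤-trans y< (m≤m+n (M + m) M)
    lowHigh : ∀ x y → x < M → M + m ≤ y → y < w → Q x y ≡ S x y
    lowHigh x y x<M M+m≤y y<w = rotate x y (low<w x<M) y<w (corner _ x (mirror-high y y<w M+m≤y) x<M)
    midHigh : ∀ x y → M ≤ x → x < M + m → M + m ≤ y → y < w → Q x y ≡ S x y
    midHigh x y M≤x x< M+m≤y y<w = rotate x y (mid<w x<) y<w (left _ x (mirror-high y y<w M+m≤y) M≤x x<)
    highHigh : ∀ x y → M + m ≤ x → x < w → M + m ≤ y → y < w → Q x y ≡ S x y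
    highHigh x y M+m≤x x<w M+m≤y y<w = rotate x y x<w y<w (lowHigh _ x (mirror-high y y<w M+m≤y) M+m≤x x<w)
    highMid : ∀ x y → M + m ≤ x → x < w → M ≤ y → y < M + m → Q x y ≡ S x y
    highMid x y M+m≤x x<w M≤y y< =
      rotate x y x<w (mid<w y<) (midHigh _ x (mirror-mid≥ y (mid<w y<) y<) (mirror-mid< y (mid<w y<) M≤y) M+m≤x x<w)
    highLow : ∀ x y → M + m ≤ x → x < w → y < M → Q x y ≡ S x y
    highLow x y M+m≤x x<w y<M =
      rotate x y x<w (low<w y<M) (highHigh _ x (mirror-low y (low<w y<M) y<M) (mirror< w y (low<w y<M)) M+m≤x x<w)
    midLow : ∀ x y → M ≤ x → x < M + m → y < M → Q x y ≡ S x y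
    midLow x y M≤x x< y<M =
      rotate x y (mid<w x<) (low<w y<M) (highMid _ x (mirror-low y (low<w y<M) y<M) (mirror< w y (low<w y<M)) M≤x x<)
    agree : ∀ x y → x < w → y < w → Q x y ≡ S x y
    agree x y x<w y<w with x <? M | x <? M + m | y <? M | y <? M + m
    ... | yes a | _     | yes c | _     = corner x y a c
    ... | yes a | _     | no c  | yes d = left x y a (≮⇒≥ c) d
    ... | yes a | _     | no c  | no d  = lowHigh x y a (≮⇒≥ d) y<w
    ... | no a  | yes b | yes c | _     = midLow x y (≮⇒≥ a) b c
    ... | no a  | yes b | no c  | yes d = centre x y (≮⇒≥ a) b (≮⇒≥ c) d
    ... | no a  | yes b | no c  | no d  = midHigh x y (≮⇒≥ a) b (≮⇒≥ d) y<w
    ... | no a  | no b  | yes c | _     = highLow x y (≮⇒≥ b) x<w c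
    ... | no a  | no b  | no c  | yes d = highMid x y (≮⇒≥ b) x<w (≮⇒≥ c) d
    ... | no a  | no b  | no c  | no d  = highHigh x y (≮⇒≥ b) x<w (≮⇒≥ d) y<w

-- The polyomino of a sequence L: a central m × m square with lower left corner (M , M) in a
-- box of side M + m + M, and four arms.  Row M + i sticks out L i cells to the left of the
-- square and Lʳ i = L (m ∸ suc i) cells to the right; column M + i sticks out Lʳ i cells
-- below and L i cells above.  Rotation by 90° exchanges the two bands.

module Cross (M m : ℕ) (L : ℕ → ℕ) where

  side : ℕ
  side = M + m + M

  Lʳ : ℕ → ℕ
  Lʳ i = L (m ∸ suc i)

  Band : (ℕ → ℕ) → (ℕ → ℕ) → ℕ → ℕ → Set
  Band below above x y = (M ≤ x × x < M + m) × (M ≤ y + below (x ∸ M) × y < M + m + above (x ∸ M))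

  band : (ℕ → ℕ) → (ℕ → ℕ) → ℕ → ℕ → Bool
  band below above x y = inRange M (M + m) x ∧ inRange (M ∸ below (x ∸ M)) (M + m + above (x ∸ M)) y

  band⁻ : ∀ p q x y → band p q x y ≡ true → Band p q x y
  band⁻ p q x y e with ∧-≡true⁻ {inRange M (M + m) x} e
  ... | ex , ey with inRange⁻ ey
  ... | lo≤y , y<hi = inRange⁻ ex , (m∸n≤o⇒m≤o+n M (p (x ∸ M)) y lo≤y , y<hi)

  band⁺ : ∀ p q x y → Band p q x y → band p q x y ≡ true
  band⁺ p q x y ((M≤x , x<) , (M≤y+p , y<)) =
    ∧-≡true (inRange⁺ M≤x x<) (inRange⁺ (m≤o+n⇒m∸n≤o M (p (x ∸ M)) y M≤y+p) y<)

  vertical horizontal : ℕ → ℕ → Bool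
  vertical   x y = band Lʳ L x y
  horizontal x y = band L Lʳ y x

  inCross : ℕ → ℕ → Bool
  inCross x y = vertical x y ∨ horizontal x y

  inCross⁻ : ∀ x y → inCross x y ≡ true → Band Lʳ L x y ⊎ Band L Lʳ y x
  inCross⁻ x y e with ∨-≡true⁻ {vertical x y} e
  ... | inj₁ v = inj₁ (band⁻ Lʳ L x y v)
  ... | inj₂ h = inj₂ (band⁻ L Lʳ y x h)

  vertical⁺ : ∀ x y → Band Lʳ L x y → inCross x y ≡ true
  vertical⁺ x y b = ∨-≡trueˡ (horizontal x y) (band⁺ Lʳ L x y b)

  horizontal⁺ : ∀ x y → Band L Lʳ y x → inCross x y ≡ true
  horizontal⁺ x y b = ∨-≡trueʳ (vertical x y) (band⁺ L Lʳ y x b)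

  inCross-rotate : RotInvariant M m inCross
  inCross-rotate x y x< y< = ≡true-ext forward backward
    where
    y' : ℕ
    y' = mirror side y
    mir : suc (y + y') ≡ side
    mir = suc[y+mirror]≡w side y y<
    M≤y⇒y'< : M ≤ y → y' < M + m
    M≤y⇒y'< = mirror-mid< M m y y<
    y<⇒M≤y' : y < M + m → M ≤ y'
    y<⇒M≤y' = mirror-mid≥ M m y y<
    y'<⇒M≤y : y' < M + m → M ≤ y
    y'<⇒M≤y y'< = ≮⇒≥ λ y<M → <⇒≱ y'< (mirror-low M m y y< y<M)
    M≤y'⇒y< : M ≤ y' → y < M + m
    M≤y'⇒y< M≤y' = ≰⇒> λ M+m≤y → <⇒≱ (mirror-high M m y y< M+m≤y) M≤y'
    Lʳ-offset : M ≤ y → y < M + m → Lʳ (y' ∸ M) ≡ L (y ∸ M)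
    Lʳ-offset M≤y y<Mm = trans (cong (λ z → L (m ∸ suc z)) (mirrored-offset M m y y' mir M≤y y<Mm))
                               (cong L (reverse-involutive m (y ∸ M) (offset< M m y M≤y y<Mm)))
    L-offset : M ≤ y → y < M + m → L (y' ∸ M) ≡ Lʳ (y ∸ M)
    L-offset M≤y y<Mm = cong L (mirrored-offset M m y y' mir M≤y y<Mm)
    forward : inCross x y ≡ true → inCross y' x ≡ true
    forward e with inCross⁻ x y e
    ... | inj₁ (x∈ , (lo , hi)) =
      horizontal⁺ y' x (x∈ , (mirrored-<⇒≤ M m y' y (L (x ∸ M)) (mirrored-sym y y' mir) hi ,
                               mirrored-≤⇒< M m y y' (Lʳ (x ∸ M)) mir lo))
    ... | inj₂ ((M≤y , y<Mm) , (lo , hi)) =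
      vertical⁺ y' x ((y<⇒M≤y' y<Mm , M≤y⇒y'< M≤y) ,
                      (subst (λ z → M ≤ x + z) (sym (Lʳ-offset M≤y y<Mm)) lo ,
                       subst (λ z → x < M + m + z) (sym (L-offset M≤y y<Mm)) hi))
    backward : inCross y' x ≡ true → inCross x y ≡ true
    backward e with inCross⁻ y' x e
    ... | inj₁ ((M≤y' , y'<) , (lo , hi)) =
      let M≤y = y'<⇒M≤y y'< ; y<Mm = M≤y'⇒y< M≤y' in
      horizontal⁺ x y ((M≤y , y<Mm) , (subst (λ z → M ≤ x + z) (Lʳ-offset M≤y y<Mm) lo ,
                                       subst (λ z → x < M + m + z) (L-offset M≤y y<Mm) hi))
    ... | inj₂ (x∈ , (lo , hi)) =
      vertical⁺ x y (x∈ , (mirrored-<⇒≤ M m y y' (Lʳ (x ∸ M)) mir hi ,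
                           mirrored-≤⇒< M m y' y (L (x ∸ M)) (mirrored-sym y y' mir) lo))

  inCross-corner : ∀ x y → x < M → y < M → inCross x y ≡ false
  inCross-corner x y x<M y<M = ¬-not λ e → outside (inCross⁻ x y e)
    where outside : Band Lʳ L x y ⊎ Band L Lʳ y x → ⊥
          outside (inj₁ ((M≤x , _) , _)) = <⇒≱ x<M M≤x
          outside (inj₂ ((M≤y , _) , _)) = <⇒≱ y<M M≤y

  inCross-centre : ∀ x y → M ≤ x → x < M + m → M ≤ y → y < M + m → inCross x y ≡ true
  inCross-centre x y M≤x x< M≤y y< =
    vertical⁺ x y ((M≤x , x<) , (≤-trans M≤y (m≤m+n y _) , <-≤-trans y< (m≤m+n (M + m) _)))

  inCross-leftArm⁻ : ∀ x i → x < M → i < m → inCross x (M + i) ≡ true → M ≤ x + L i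
  inCross-leftArm⁻ x i x<M i<m e with inCross⁻ x (M + i) e
  ... | inj₁ ((M≤x , _) , _) = ⊥-elim (<⇒≱ x<M M≤x)
  ... | inj₂ (_ , (lo , _))  = subst (λ z → M ≤ x + L z) (m+n∸m≡n M i) lo

  inCross-leftArm⁺ : ∀ x i → x < M → i < m → M ≤ x + L i → inCross x (M + i) ≡ true
  inCross-leftArm⁺ x i x<M i<m M≤x+Li =
    horizontal⁺ x (M + i) ((m≤m+n M i , +-monoʳ-< M i<m) ,
      (subst (λ z → M ≤ x + L z) (sym (m+n∸m≡n M i)) M≤x+Li ,
       <-≤-trans x<M (≤-trans (m≤m+n M m) (m≤m+n (M + m) _))))

  grid : Grid side side
  grid = tabulateGrid side side inCross

module CrossPolyomino (M m : ℕ) (L : ℕ → ℕ) (L≤M : ∀ i → i < m → L i ≤ M) where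
  open Cross M m L

  Lʳ≤M : ∀ i → i < m → Lʳ i ≤ M
  Lʳ≤M i i<m = L≤M (m ∸ suc i) (reverse< m i i<m)

  M+m≤side : M + m ≤ side
  M+m≤side = m≤m+n (M + m) M

  inCross⇒inBox : ∀ x y → inCross x y ≡ true → x < side × y < side
  inCross⇒inBox x y e with inCross⁻ x y e
  ... | inj₁ ((M≤x , x<) , (_ , y<)) =
    <-≤-trans x< M+m≤side , <-≤-trans y< (+-monoʳ-≤ (M + m) (L≤M (x ∸ M) (offset< M m x M≤x x<)))
  ... | inj₂ ((M≤y , y<) , (_ , x<)) =
    <-≤-trans x< (+-monoʳ-≤ (M + m) (Lʳ≤M (y ∸ M) (offset< M m y M≤y y<))) , <-≤-trans y< M+m≤side

  In-grid⁺ : ∀ x y → inCross x y ≡ true → In grid x y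
  In-grid⁺ x y e with inCross⇒inBox x y e
  ... | x< , y< = trans (cell-tabulateGrid side side inCross x y x< y<) e

  In-grid⁻ : ∀ x y → In grid x y → inCross x y ≡ true
  In-grid⁻ x y e with In⇒inBox grid x y e
  ... | x< , y< = trans (sym (cell-tabulateGrid side side inCross x y x< y<)) e

  grid-rot90 : ∀ x y → x < side → y < side → cell grid x y ≡ cell grid (mirror side y) x
  grid-rot90 x y x< y< = begin
    cell grid x y             ≡⟨ cell-tabulateGrid side side inCross x y x< y< ⟩
    inCross x y               ≡⟨ inCross-rotate x y x< y< ⟩
    inCross (mirror side y) x ≡⟨ sym (cell-tabulateGrid side side inCross _ x (mirror< side y y<) x<) ⟩
    cell grid (mirror side y) x ∎
    where open ≡-Reasoning

  ∑-band : ∀ p q → (∀ i → i < m → p i ≤ M) → (∀ i → i < m → q i ≤ M) → ∀ x →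
           ∑[ y < side ] 𝟙 (band p q x y) ≡ 𝟙 (inRange M (M + m) x) * (m + q (x ∸ M) + p (x ∸ M))
  ∑-band p q p≤M q≤M x with inRange M (M + m) x in x∈
  ... | false = ∑-zero side _ (λ _ _ → refl)
  ... | true  = trans (count-inRange side lo hi hi≤side) (trans hi∸lo (sym (+-identityʳ _)))
    where
    x∈' : M ≤ x × x < M + m
    x∈' = inRange⁻ x∈
    j lo hi : ℕ
    j = x ∸ M
    lo = M ∸ p j
    hi = M + m + q j
    j<m : j < m
    j<m = offset< M m x (proj₁ x∈') (proj₂ x∈')
    hi≤side : hi ≤ side
    hi≤side = +-monoʳ-≤ (M + m) (q≤M j j<m)
    hi∸lo : hi ∸ lo ≡ m + q j + p j
    hi∸lo = begin
      M + m + q j ∸ lo                   ≡⟨ cong (λ z → z + m + q j ∸ lo) (sym (m∸n+n≡m (p≤M j j<m))) ⟩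
      lo + p j + m + q j ∸ lo            ≡⟨ cong (_∸ lo) (shuffle lo (p j) m (q j)) ⟩
      lo + (m + q j + p j) ∸ lo          ≡⟨ m+n∸m≡n lo _ ⟩
      m + q j + p j                      ∎
      where open ≡-Reasoning
            shuffle : ∀ a b c d → a + b + c + d ≡ a + (c + d + b)
            shuffle = solve-∀

  ∑∑-band : ∀ p q → (∀ i → i < m → p i ≤ M) → (∀ i → i < m → q i ≤ M) →
            ∑[ x < side ] ∑[ y < side ] 𝟙 (band p q x y) ≡ m * m + ∑< m q + ∑< m p
  ∑∑-band p q p≤M q≤M = begin
    ∑[ x < side ] ∑[ y < side ] 𝟙 (band p q x y)
      ≡⟨ ∑-cong side _ _ (λ x _ → ∑-band p q p≤M q≤M x) ⟩
    ∑[ x < side ] (𝟙 (inRange M (M + m) x) * (m + q (x ∸ M) + p (x ∸ M)))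
      ≡⟨ ∑-inRange M m side (λ i → m + q i + p i) M+m≤side ⟩
    ∑[ i < m ] (m + q i + p i)
      ≡⟨ ∑-distrib-+ m (λ i → m + q i) p ⟩
    ∑[ i < m ] (m + q i) + ∑< m p
      ≡⟨ cong (_+ ∑< m p) (trans (∑-distrib-+ m (λ _ → m) q) (cong (_+ ∑< m q) (∑-const m m))) ⟩
    m * m + ∑< m q + ∑< m p ∎
    where open ≡-Reasoning

  noArm : ℕ → ℕ
  noArm _ = 0

  centre : ℕ → ℕ → Bool
  centre = band noArm noArm

  vertical∧horizontal≡centre : ∀ x y → vertical x y ∧ horizontal x y ≡ centre x y
  vertical∧horizontal≡centre x y = ≡true-ext forward backward
    where
    forward : vertical x y ∧ horizontal x y ≡ true → centre x y ≡ true
    forward e with ∧-≡true⁻ {vertical x y} e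
    ... | v , h with band⁻ Lʳ L x y v | band⁻ L Lʳ y x h
    ... | x∈ , _ | (M≤y , y<) , _ =
      band⁺ noArm noArm x y (x∈ , (subst (M ≤_) (sym (+-identityʳ y)) M≤y ,
                                   subst (y <_) (sym (+-identityʳ (M + m))) y<))
    backward : centre x y ≡ true → vertical x y ∧ horizontal x y ≡ true
    backward e with band⁻ noArm noArm x y e
    ... | (M≤x , x<) , (M≤y+0 , y<+0) =
      let M≤y = subst (M ≤_) (+-identityʳ y) M≤y+0
          y<  = subst (y <_) (+-identityʳ (M + m)) y<+0 in
      ∧-≡true (band⁺ Lʳ L x y ((M≤x , x<) , (≤-trans M≤y (m≤m+n y _) , <-≤-trans y< (m≤m+n (M + m) _))))
              (band⁺ L Lʳ y x ((M≤y , y<) , (≤-trans M≤x (m≤m+n x _) , <-≤-trans x< (m≤m+n (M + m) _))))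

  -- Inclusion–exclusion: the two bands overlap exactly in the central square.
  ∑∑-inCross : ∑[ x < side ] ∑[ y < side ] 𝟙 (inCross x y) ≡ m * m + 4 * ∑< m L
  ∑∑-inCross = +-cancelʳ-≡ C (∑∑ inCross) (m * m + 4 * ∑< m L) (begin
    ∑∑ inCross + ∑∑ (λ x y → vertical x y ∧ horizontal x y)
      ≡⟨ sym (∑∑-distrib-+ (λ x y → 𝟙 (inCross x y)) (λ x y → 𝟙 (vertical x y ∧ horizontal x y))) ⟩
    ∑[ x < side ] ∑[ y < side ] (𝟙 (inCross x y) + 𝟙 (vertical x y ∧ horizontal x y))
      ≡⟨ ∑-cong side _ _ (λ x _ → ∑-cong side _ _ (λ y _ → 𝟙-∨+∧ (vertical x y) (horizontal x y))) ⟩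
    ∑[ x < side ] ∑[ y < side ] (𝟙 (vertical x y) + 𝟙 (horizontal x y))
      ≡⟨ ∑∑-distrib-+ (λ x y → 𝟙 (vertical x y)) (λ x y → 𝟙 (horizontal x y)) ⟩
    ∑∑ vertical + ∑∑ horizontal
      ≡⟨ cong₂ _+_ (∑∑-band Lʳ L Lʳ≤M L≤M)
                   (trans (∑-comm side side (λ x y → 𝟙 (horizontal x y))) (∑∑-band L Lʳ L≤M Lʳ≤M)) ⟩
    (m * m + ∑< m L + ∑< m Lʳ) + (m * m + ∑< m Lʳ + ∑< m L)
      ≡⟨ cong (λ z → (m * m + ∑< m L + z) + (m * m + z + ∑< m L)) (∑-reverse m L) ⟩
    (m * m + ∑< m L + ∑< m L) + (m * m + ∑< m L + ∑< m L)
      ≡⟨ shuffle (m * m) (∑< m L) ⟩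
    m * m + 4 * ∑< m L + (m * m + 0 + 0)
      ≡⟨ cong (m * m + 4 * ∑< m L +_) (sym centreSize) ⟩
    m * m + 4 * ∑< m L + C ∎)
    where
    open ≡-Reasoning
    ∑∑ : (ℕ → ℕ → Bool) → ℕ
    ∑∑ f = ∑[ x < side ] ∑[ y < side ] 𝟙 (f x y)
    C : ℕ
    C = ∑∑ (λ x y → vertical x y ∧ horizontal x y)
    ∑∑-distrib-+ : ∀ (f g : ℕ → ℕ → ℕ) → ∑[ x < side ] ∑[ y < side ] (f x y + g x y) ≡
                   ∑[ x < side ] ∑< side (f x) + ∑[ x < side ] ∑< side (g x)
    ∑∑-distrib-+ f g = trans (∑-cong side _ _ (λ x _ → ∑-distrib-+ side (f x) (g x)))
                             (∑-distrib-+ side (λ x → ∑< side (f x)) (λ x → ∑< side (g x)))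
    centreSize : C ≡ m * m + 0 + 0
    centreSize = trans (∑-cong side _ _ (λ x _ →
                          ∑-cong side _ _ (λ y _ → cong 𝟙 (vertical∧horizontal≡centre x y))))
                 (trans (∑∑-band noArm noArm (λ _ _ → z≤n) (λ _ _ → z≤n))
                        (cong₂ (λ a b → m * m + a + b) (∑-zero m _ (λ _ _ → refl)) (∑-zero m _ (λ _ _ → refl))))
    shuffle : ∀ a b → (a + b + b) + (a + b + b) ≡ a + 4 * b + (a + 0 + 0)
    shuffle = solve-∀

  area-grid : area grid ≡ m * m + 4 * ∑< m L
  area-grid = trans (area≡∑cells grid)
    (trans (∑-cong side _ _ (λ x x< →
              ∑-cong side _ _ (λ y y< → cong 𝟙 (cell-tabulateGrid side side inCross x y x< y<))))
           ∑∑-inCross)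

  module _ (qc : Quasiconcave L m) where

    private
      rowConvex-outsideCentre : ∀ y x₁ x₂ x → inCross x₁ y ≡ true → inCross x₂ y ≡ true → x₁ ≤ x → x ≤ x₂ →
                                ¬ (M ≤ y × y < M + m) → inCross x y ≡ true
      rowConvex-outsideCentre y x₁ x₂ x e₁ e₂ x₁≤x x≤x₂ y∉ =
        vertical⁺ x y ((≤-trans (proj₁ (proj₁ b₁)) x₁≤x , ≤-<-trans x≤x₂ (proj₂ (proj₁ b₂))) , (lower , upper))
        where
        inVertical : ∀ x' → inCross x' y ≡ true → Band Lʳ L x' y
        inVertical x' e with inCross⁻ x' y e
        ... | inj₁ b = b
        ... | inj₂ (y∈ , _) = ⊥-elim (y∉ y∈)
        b₁ : Band Lʳ L x₁ y
        b₁ = inVertical x₁ e₁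
        b₂ : Band Lʳ L x₂ y
        b₂ = inVertical x₂ e₂
        i j k : ℕ
        i = x₁ ∸ M
        j = x ∸ M
        k = x₂ ∸ M
        i≤j : i ≤ j
        i≤j = ∸-monoˡ-≤ M x₁≤x
        j≤k : j ≤ k
        j≤k = ∸-monoˡ-≤ M x≤x₂
        k<m : k < m
        k<m = offset< M m x₂ (proj₁ (proj₁ b₂)) (proj₂ (proj₁ b₂))
        lower : M ≤ y + Lʳ j
        lower = m∸n≤o⇒m≤n+o M y (Lʳ j)
          (quasiconcave-reverse L m qc i j k (M ∸ y) i≤j j≤k k<m
            (m≤n+o⇒m∸n≤o M y (proj₁ (proj₂ b₁))) (m≤n+o⇒m∸n≤o M y (proj₁ (proj₂ b₂))))
        upper : y < M + m + L j
        upper = m∸n≤o⇒m≤n+o (suc y) (M + m) (L j)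
          (qc i j k (suc y ∸ (M + m)) i≤j j≤k k<m
            (m≤n+o⇒m∸n≤o (suc y) (M + m) (proj₂ (proj₂ b₁))) (m≤n+o⇒m∸n≤o (suc y) (M + m) (proj₂ (proj₂ b₂))))

    inCross-rowConvex : ∀ y x₁ x₂ x → inCross x₁ y ≡ true → inCross x₂ y ≡ true → x₁ ≤ x → x ≤ x₂ →
                        inCross x y ≡ true
    inCross-rowConvex y x₁ x₂ x e₁ e₂ x₁≤x x≤x₂ with M ≤? y | y <? M + m
    ... | yes M≤y | yes y< =
      horizontal⁺ x y ((M≤y , y<) , (≤-trans (proj₁ (inRow x₁ e₁)) (+-monoˡ-≤ _ x₁≤x) ,
                                     ≤-<-trans x≤x₂ (proj₂ (inRow x₂ e₂))))
      where
      inRow : ∀ x' → inCross x' y ≡ true → M ≤ x' + L (y ∸ M) × x' < M + m + Lʳ (y ∸ M)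
      inRow x' e with inCross⁻ x' y e
      ... | inj₁ ((M≤x' , x'<) , _) = ≤-trans M≤x' (m≤m+n x' _) , <-≤-trans x'< (m≤m+n (M + m) _)
      ... | inj₂ (_ , bounds) = bounds
    ... | no M≰y | _      = rowConvex-outsideCentre y x₁ x₂ x e₁ e₂ x₁≤x x≤x₂ (λ y∈ → M≰y (proj₁ y∈))
    ... | yes _  | no y≮ = rowConvex-outsideCentre y x₁ x₂ x e₁ e₂ x₁≤x x≤x₂ (λ y∈ → y≮ (proj₂ y∈))

    inCross-columnConvex : ∀ x y₁ y₂ y → inCross x y₁ ≡ true → inCross x y₂ ≡ true → y₁ ≤ y → y ≤ y₂ →
                           inCross x y ≡ true
    inCross-columnConvex x y₁ y₂ y e₁ e₂ y₁≤y y≤y₂ =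
      trans (inCross-rotate x y x< y<)
        (inCross-rowConvex x (mirror side y₂) (mirror side y₁) (mirror side y)
          (trans (sym (inCross-rotate x y₂ x< y₂<)) e₂) (trans (sym (inCross-rotate x y₁ x< y₁<)) e₁)
          (∸-monoʳ-≤ (side ∸ 1) y≤y₂) (∸-monoʳ-≤ (side ∸ 1) y₁≤y))
      where
      x< : x < side
      x<  = proj₁ (inCross⇒inBox x y₂ e₂)
      y₂< : y₂ < side
      y₂< = proj₂ (inCross⇒inBox x y₂ e₂)
      y₁< : y₁ < side
      y₁< = proj₂ (inCross⇒inBox x y₁ e₁)
      y< : y < side
      y<  = ≤-<-trans y≤y₂ y₂<

    grid-convex : Convex grid
    grid-convex =
      (λ y x₁ x₂ x e₁ e₂ x₁≤x x≤x₂ →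
         In-grid⁺ x y (inCross-rowConvex y x₁ x₂ x (In-grid⁻ x₁ y e₁) (In-grid⁻ x₂ y e₂) x₁≤x x≤x₂)) ,
      (λ x y₁ y₂ y e₁ e₂ y₁≤y y≤y₂ →
         In-grid⁺ x y (inCross-columnConvex x y₁ y₂ y (In-grid⁻ x y₁ e₁) (In-grid⁻ x y₂ e₂) y₁≤y y≤y₂))

  module _ (1≤m : 1 ≤ m) where

    M<M+m : M < M + m
    M<M+m = m<m+n M 1≤m

    private
      centreFull : ∀ x y → M ≤ x → x < M + m → M ≤ y → y < M + m → In grid x y
      centreFull x y M≤x x< M≤y y< = In-grid⁺ x y (inCross-centre x y M≤x x< M≤y y<)

      M<M+m+_ : ∀ n → M < M + m + n
      M<M+m+ n = <-≤-trans M<M+m (m≤m+n (M + m) n)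

    -- The paths run inside the band of the cell and the central square.
    reach-centre : ∀ x y → inCross x y ≡ true → Reach grid (x , y) (M , M) × Reach grid (M , M) (x , y)
    reach-centre x y e with inCross⁻ x y e
    ... | inj₁ ((M≤x , x<) , (lo≤y , y<)) =
      Reach-trans grid (Reach-inColumn grid x lo hi y M column (m≤o+n⇒m∸n≤o M _ y lo≤y) y<
                                       (m∸n≤m M (Lʳ (x ∸ M))) (M<M+m+ _))
                       (Reach-inRow grid M M (M + m) x M row M≤x x< ≤-refl M<M+m) ,
      Reach-trans grid (Reach-inRow grid M M (M + m) M x row ≤-refl M<M+m M≤x x<)
                       (Reach-inColumn grid x lo hi M y column (m∸n≤m M (Lʳ (x ∸ M))) (M<M+m+ _)
                                       (m≤o+n⇒m∸n≤o M _ y lo≤y) y<)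
      where
      lo hi : ℕ
      lo = M ∸ Lʳ (x ∸ M)
      hi = M + m + L (x ∸ M)
      column : ∀ y' → lo ≤ y' → y' < hi → In grid x y'
      column y' p q = In-grid⁺ x y' (vertical⁺ x y' ((M≤x , x<) , (m∸n≤o⇒m≤o+n M _ y' p , q)))
      row : ∀ x' → M ≤ x' → x' < M + m → In grid x' M
      row x' p q = centreFull x' M p q ≤-refl M<M+m
    ... | inj₂ ((M≤y , y<) , (lo≤x , x<)) =
      Reach-trans grid (Reach-inRow grid y lo hi x M row (m≤o+n⇒m∸n≤o M _ x lo≤x) x<
                                    (m∸n≤m M (L (y ∸ M))) (M<M+m+ _))
                       (Reach-inColumn grid M M (M + m) y M column M≤y y< ≤-refl M<M+m) ,
      Reach-trans grid (Reach-inColumn grid M M (M + m) M y column ≤-refl M<M+m M≤y y<)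
                       (Reach-inRow grid y lo hi M x row (m∸n≤m M (L (y ∸ M))) (M<M+m+ _)
                                    (m≤o+n⇒m∸n≤o M _ x lo≤x) x<)
      where
      lo hi : ℕ
      lo = M ∸ L (y ∸ M)
      hi = M + m + Lʳ (y ∸ M)
      row : ∀ x' → lo ≤ x' → x' < hi → In grid x' y
      row x' p q = In-grid⁺ x' y (horizontal⁺ x' y ((M≤y , y<) , (m∸n≤o⇒m≤o+n M _ x' p , q)))
      column : ∀ y' → M ≤ y' → y' < M + m → In grid M y'
      column y' p q = centreFull M y' ≤-refl M<M+m p q

    grid-connected : EdgeConnected grid
    grid-connected x y x' y' e e' =
      Reach-trans grid (proj₁ (reach-centre x y (In-grid⁻ x y e)))
                       (proj₂ (reach-centre x' y' (In-grid⁻ x' y' e')))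

    module _ (i : ℕ) (i<m : i < m) (Li≡M : L i ≡ M) where

      column-nonempty : ∀ x → x < side → ∃ λ y → inCross x y ≡ true
      column-nonempty x x< with x <? M | x <? M + m
      ... | yes x<M | _ =
        M + i , inCross-leftArm⁺ x i x<M i<m (subst (λ z → M ≤ x + z) (sym Li≡M) (m≤n+m M x))
      ... | no x≮M | yes x<M+m = M , inCross-centre x M (≮⇒≥ x≮M) x<M+m ≤-refl M<M+m
      ... | no _ | no x≮M+m =
        M + j , horizontal⁺ x (M + j) ((m≤m+n M j , +-monoʳ-< M (reverse< m i i<m)) ,
          (subst (λ z → M ≤ x + L z) (sym (m+n∸m≡n M j))
                 (≤-trans (≤-trans (m≤m+n M m) (≮⇒≥ x≮M+m)) (m≤m+n x _)) ,
           subst (λ z → x < M + m + Lʳ z) (sym (m+n∸m≡n M j)) (subst (λ z → x < M + m + z) (sym Lʳj≡M) x<)))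
        where
        j : ℕ
        j = m ∸ suc i
        Lʳj≡M : Lʳ j ≡ M
        Lʳj≡M = trans (cong L (reverse-involutive m i i<m)) Li≡M

      grid-tight : TightBox grid
      grid-tight = ≤-trans 1≤m (≤-trans (m≤n+m m M) M+m≤side) , columns , rows
        where
        columns : ∀ x → x < side → ∃ λ y → In grid x y
        columns x x< with column-nonempty x x<
        ... | y , e = y , In-grid⁺ x y e
        rows : ∀ y → y < side → ∃ λ x → In grid x y
        rows y y< with column-nonempty (mirror side y) (mirror< side y y<)
        ... | x , e = x , In-grid⁺ x y (trans (inCross-rotate x y (proj₂ (inCross⇒inBox _ x e)) y<) e)

module ConvexPolyomino {w h} (g : Grid w h) (convex : Convex g) (connected : EdgeConnected g) where

  rowConvex : ∀ y x₁ x₂ x → In g x₁ y → In g x₂ y → x₁ ≤ x → x ≤ x₂ → In g x y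
  rowConvex = proj₁ convex

  columnConvex : ∀ x y₁ y₂ y → In g x y₁ → In g x y₂ → y₁ ≤ y → y ≤ y₂ → In g x y
  columnConvex = proj₂ convex

  -- By induction on e, a path from (a , b) to (e , y) enters column e above b; column
  -- convexity then puts (e , b) in P, and row convexity fills in (a + 1 , b).
  emptyBelowRight : ∀ a b r → In g a b → ¬ In g (suc a) b → In g (suc a) r → b < r →
                    ∀ e y → a < e → y ≤ b → ¬ In g e y
  emptyBelowRight a b r ab ¬a+1b a+1r b<r (suc e) y a<e y≤b ey with m≤n⇒m<n∨m≡n (s≤s⁻¹ a<e)
  ... | inj₂ refl = ¬a+1b (columnConvex (suc a) y r b ey a+1r y≤b (<⇒≤ b<r))
  ... | inj₁ a<e' = ¬a+1b (rowConvex b a (suc e) (suc a) ab eb (n≤1+n a) (s≤s (<⇒≤ a<e')))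
    where
    crossing : ∃ λ r' → In g e r' × In g (suc e) r'
    crossing = Reach-crossesColumn g e ab (connected a b (suc e) y ab ey) (<⇒≤ a<e') ≤-refl
    b<r' : b < proj₁ crossing
    b<r' = ≰⇒> λ r'≤b → emptyBelowRight a b r ab ¬a+1b a+1r b<r e _ a<e' r'≤b (proj₁ (proj₂ crossing))
    eb : In g (suc e) b
    eb = columnConvex (suc e) y (proj₁ crossing) b ey (proj₂ (proj₂ crossing)) y≤b (<⇒≤ b<r')

  private
    DiagonalBetween : ℕ → ℕ → Set
    DiagonalBetween b c = ∃ λ k → k ≤ b × k ≤ c × In g k k

    sub-suc : ∀ a c → a < c → suc (c ∸ suc a) ≡ c ∸ a
    sub-suc a (suc c) (s≤s a≤c) = sym (+-∸-assoc 1 a≤c)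

    -- Induction on the distance (c ∸ a) + (b ∸ d) between a cell above and a cell below the
    -- diagonal: step from (a , b) right or down inside P, or derive a contradiction.
    diagonal≤ : ∀ F a b c d → (c ∸ a) + (b ∸ d) ≤ F → In g a b → In g c d →
                a ≤ c → d ≤ b → a ≤ b → d ≤ c → DiagonalBetween b c
    diagonal< : ∀ F a b c d → (c ∸ a) + (b ∸ d) ≤ F → In g a b → In g c d →
                a < c → d < b → a < b → d < c → DiagonalBetween b c
    diagonal≤ F a b c d μ ab cd a≤c d≤b a≤b d≤c with a ≟ b | c ≟ d | a ≟ c | d ≟ b
    ... | yes refl | _        | _        | _        = a , ≤-refl , a≤c , ab
    ... | no _     | yes refl | _        | _        = c , d≤b , ≤-refl , cd
    ... | no _     | no _     | yes refl | _        = a , a≤b , ≤-refl , columnConvex a d b a cd ab d≤c a≤b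
    ... | no _     | no _     | no _     | yes refl = b , ≤-refl , d≤c , rowConvex b a c b ab cd a≤b d≤c
    ... | no a≢b   | no c≢d   | no a≢c   | no d≢b   =
      diagonal< F a b c d μ ab cd (≤∧≢⇒< a≤c a≢c) (≤∧≢⇒< d≤b d≢b) (≤∧≢⇒< a≤b a≢b)
                (≤∧≢⇒< d≤c (λ e → c≢d (sym e)))
    diagonal< zero a b c d μ ab cd a<c d<b a<b d<c =
      ⊥-elim (<⇒≱ (subst (0 <_) (sub-suc a c a<c) z<s) (≤-trans (m≤m+n (c ∸ a) _) μ))
    diagonal< (suc F) a (suc b) c d μ ab cd a<c d<b a<b d<c with (cell g (suc a) (suc b)) ≟ᵇ true
    ... | yes right = diagonal≤ F (suc a) (suc b) c d μ' right cd a<c (<⇒≤ d<b) a<b (<⇒≤ d<c)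
      where μ' : (c ∸ suc a) + (suc b ∸ d) ≤ F
            μ' = s≤s⁻¹ (subst (_≤ suc F) (cong (_+ (suc b ∸ d)) (sym (sub-suc a c a<c))) μ)
    ... | no ¬right with (cell g a b) ≟ᵇ true
    ... | yes down with diagonal≤ F a b c d μ' down cd (<⇒≤ a<c) (s≤s⁻¹ d<b) (s≤s⁻¹ a<b) (<⇒≤ d<c)
      where μ' : (c ∸ a) + (b ∸ d) ≤ F
            μ' = s≤s⁻¹ (subst (_≤ suc F)
                   (trans (cong ((c ∸ a) +_) (sym (sub-suc d (suc b) d<b))) (+-suc (c ∸ a) (b ∸ d))) μ)
    ... | k , k≤b , k≤c , kk = k , m≤n⇒m≤1+n k≤b , k≤c , kk
    diagonal< (suc F) a (suc b) c d μ ab cd a<c d<b a<b d<c | no ¬right | no ¬down =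
      ⊥-elim (emptyBelowRight a (suc b) r ab ¬right (proj₂ (proj₂ crossing)) b<r c d a<c (<⇒≤ d<b) cd)
      where
      crossing : ∃ λ r → In g a r × In g (suc a) r
      crossing = Reach-crossesColumn g a ab (connected a (suc b) c d ab cd) ≤-refl a<c
      r : ℕ
      r = proj₁ crossing
      b<r : suc b < r
      b<r = ≤∧≢⇒< (≰⇒> λ r≤b → ¬down (columnConvex a r (suc b) b (proj₁ (proj₂ crossing)) ab r≤b (n≤1+n b)))
                  (λ e → ¬right (subst (In g (suc a)) (sym e) (proj₂ (proj₂ crossing))))

  diagonalBetween : ∀ a b c d → In g a b → In g c d → a ≤ c → d ≤ b → a ≤ b → d ≤ c →
                    ∃ λ k → k ≤ b × k ≤ c × In g k k
  diagonalBetween a b c d = diagonal≤ _ a b c d ≤-refl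

-- The first diagonal cell (M , M) of a rotation-invariant convex polyomino is the lower left
-- corner of its central square, of side m = w ∸ 2M, and row M + i meets the left arm in
-- armLength g i cells.

diagonalStart : ∀ {w h} → Grid w h → ℕ
diagonalStart {w} g = firstTrue w (λ k → cell g k k)

centreSize : ∀ {w h} → Grid w h → ℕ
centreSize {w} g = w ∸ (diagonalStart g + diagonalStart g)

armLength : ∀ {w h} → Grid w h → ℕ → ℕ
armLength g i = count (diagonalStart g) (λ x → cell g x (diagonalStart g + i))

armSequence : ∀ {w h} (g : Grid w h) → Vec ℕ (centreSize g)
armSequence g = tabulateℕ (centreSize g) (armLength g)

module RotationInvariantConvex {w} (g : Grid w w)
  (rot : ∀ x y → x < w → y < w → cell g x y ≡ cell g (mirror w y) x)
  (convex : Convex g) (connected : EdgeConnected g) (tight : TightBox g) where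

  open ConvexPolyomino g convex connected

  inBox : ∀ {x y} → In g x y → x < w × y < w
  inBox {x} {y} = In⇒inBox g x y

  rotate : ∀ {x y} → In g x y → In g (mirror w y) x
  rotate {x} {y} e = trans (sym (rot x y (proj₁ (inBox e)) (proj₂ (inBox e)))) e

  rotate⁻¹ : ∀ {x y} → In g x y → In g y (mirror w x)
  rotate⁻¹ {x} {y} e =
    subst (λ z → In g z (mirror w x)) (mirror-involutive w y (proj₂ (inBox e))) (rotate (rotate (rotate e)))

  diagonal-nonempty : ∃ λ k → k < w × In g k k
  diagonal-nonempty with proj₁ (proj₂ tight) 0 (proj₁ tight)
  ... | y , 0y with diagonalBetween 0 y (mirror w y) 0 0y (rotate 0y) z≤n z≤n z≤n z≤n
  ... | k , k≤y , _ , kk = k , ≤-<-trans k≤y (proj₂ (inBox 0y)) , kk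

  M : ℕ
  M = diagonalStart g

  private
    firstDiagonal : In g M M × M ≤ proj₁ diagonal-nonempty
    firstDiagonal = firstTrue-true w (λ k → cell g k k) (proj₁ diagonal-nonempty)
                      (proj₁ (proj₂ diagonal-nonempty)) (proj₂ (proj₂ diagonal-nonempty))

  MM : In g M M
  MM = proj₁ firstDiagonal

  M<w : M < w
  M<w = ≤-<-trans (proj₂ firstDiagonal) (proj₁ (proj₂ diagonal-nonempty))

  M-minimal : ∀ j → j < M → ¬ In g j j
  M-minimal j j<M jj = true≢false (trans (sym jj) (firstTrue-minimal w (λ k → cell g k k) j j<M))

  M+M<w : M + M < w
  M+M<w = ≤-<-trans (m≤o∸n⇒m+n≤o M (pred-≤ M<w) M≤mirror) (pred< M<w)
    where
    pred-≤ : ∀ {x w} → x < w → x ≤ w ∸ 1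
    pred-≤ (s≤s x≤w) = x≤w
    pred< : ∀ {x w} → x < w → w ∸ 1 < w
    pred< (s≤s _) = ≤-refl
    M≤mirror : M ≤ mirror w M
    M≤mirror = ≮⇒≥ λ lt → M-minimal _ lt (rotate (rotate MM))

  corner-empty : ∀ x y → x < M → y < M → ¬ In g x y
  corner-empty x y x<M y<M xy with x ≤? y
  ... | yes x≤y = below (diagonalBetween x y (mirror w y) x xy (rotate xy) x≤y' x≤y x≤y x≤y')
    where
    x≤y' : x ≤ mirror w y
    x≤y' = +<⇒≤mirror w x y (<-trans (+-mono-< x<M y<M) M+M<w)
    below : (∃ λ k → k ≤ y × k ≤ mirror w y × In g k k) → ⊥
    below (k , k≤y , _ , kk) = M-minimal k (≤-<-trans k≤y y<M) kk
  ... | no x≰y = below (diagonalBetween y (mirror w x) x y (rotate⁻¹ xy) xy y≤x y≤x' y≤x' y≤x)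
    where
    y≤x : y ≤ x
    y≤x = <⇒≤ (≰⇒> x≰y)
    y≤x' : y ≤ mirror w x
    y≤x' = +<⇒≤mirror w y x (<-trans (+-mono-< y<M x<M) M+M<w)
    below : (∃ λ k → k ≤ mirror w x × k ≤ x × In g k k) → ⊥
    below (k , _ , k≤x , kk) = M-minimal k (≤-<-trans k≤x x<M) kk

  m : ℕ
  m = centreSize g

  side≡w : M + m + M ≡ w
  side≡w = trans (+-assoc M m M) (trans (cong (M +_) (+-comm m M))
                 (trans (sym (+-assoc M M m)) (m+[n∸m]≡n (<⇒≤ M+M<w))))

  1≤m : 1 ≤ m
  1≤m = m<n⇒0<n∸m M+M<w

  M<M+m : M < M + m
  M<M+m = m<m+n M 1≤m

  centre-full : ∀ x y → M ≤ x → x < M + m → M ≤ y → y < M + m → In g x y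
  centre-full x y M≤x x< M≤y y< = columnConvex x M t y xM xt M≤y (≤t y y<)
    where
    t : ℕ
    t = mirror w M
    ≤t : ∀ z → z < M + m → z ≤ t
    ≤t z z< = +<⇒≤mirror w z M (subst (z + M <_) side≡w (+-monoˡ-< M z<))
    xM : In g x M
    xM = rowConvex M M t x MM (rotate MM) M≤x (≤t x x<)
    xt : In g x t
    xt = rowConvex t M t x (rotate⁻¹ MM) (rotate (rotate MM)) M≤x (≤t x x<)

  ℓ : ℕ → ℕ
  ℓ = armLength g

  leftArm : ∀ x i → x < M → i < m → (In g x (M + i) → M ≤ x + ℓ i) × (M ≤ x + ℓ i → In g x (M + i))
  leftArm x i x<M i<m = upClosed-threshold M (λ x → cell g x (M + i)) towardsCentre x x<M
    where
    towardsCentre : UpClosed M (λ x → cell g x (M + i))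
    towardsCentre a b a≤b b<M e =
      rowConvex (M + i) a M b e (centre-full M (M + i) ≤-refl M<M+m (m≤m+n M i) (+-monoʳ-< M i<m)) a≤b (<⇒≤ b<M)

  ℓ≤M : ∀ i → ℓ i ≤ M
  ℓ≤M i = count≤ M _

  ℓ-quasiconcave : Quasiconcave ℓ m
  ℓ-quasiconcave i j k zero    i≤j j≤k k<m c≤ℓi c≤ℓk = z≤n
  ℓ-quasiconcave i j k (suc c) i≤j j≤k k<m c≤ℓi c≤ℓk =
    +-cancelˡ-≤ x (suc c) (ℓ j) (subst (_≤ x + ℓ j) (sym x+c≡M) (proj₁ (leftArm x j x<M j<m) xj))
    where
    c<M : suc c ≤ M
    c<M = ≤-trans c≤ℓi (ℓ≤M i)
    x : ℕ
    x = M ∸ suc c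
    x+c≡M : x + suc c ≡ M
    x+c≡M = m∸n+n≡m c<M
    x<M : x < M
    x<M = reverse< M c c<M
    j<m : j < m
    j<m = ≤-<-trans j≤k k<m
    xi : In g x (M + i)
    xi = proj₂ (leftArm x i x<M (≤-<-trans i≤j j<m)) (subst (_≤ x + ℓ i) x+c≡M (+-monoʳ-≤ x c≤ℓi))
    xk : In g x (M + k)
    xk = proj₂ (leftArm x k x<M k<m) (subst (_≤ x + ℓ k) x+c≡M (+-monoʳ-≤ x c≤ℓk))
    xj : In g x (M + j)
    xj = columnConvex x (M + i) (M + k) (M + j) xi xk (+-monoʳ-≤ M i≤j) (+-monoʳ-≤ M j≤k)

  -- The leftmost column meets the polyomino, and only in the rows of the central square.
  ℓ-peak : ∃ λ i → i < m × M ≤ ℓ i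
  ℓ-peak with 0 <? M | proj₁ (proj₂ tight) 0 (proj₁ tight)
  ... | no M≯0 | _ = 0 , 1≤m , ≤-trans (≮⇒≥ M≯0) z≤n
  ... | yes 0<M | y , 0y with y <? M | y <? M + m
  ... | yes y<M | _ = ⊥-elim (corner-empty 0 y 0<M y<M 0y)
  ... | no y≮M | yes y< =
    i , i<m , proj₁ (leftArm 0 i 0<M i<m) (subst (In g 0) (sym (m+[n∸m]≡n (≮⇒≥ y≮M))) 0y)
    where
    i : ℕ
    i = y ∸ M
    i<m : i < m
    i<m = offset< M m y (≮⇒≥ y≮M) y<
  ... | no _ | no y≮ = ⊥-elim (corner-empty (mirror w y) 0 mirror<M 0<M (rotate 0y))
    where
    mirror<M : mirror w y < M
    mirror<M = subst (λ z → mirror z y < M) side≡w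
      (mirror-high M m y (subst (y <_) (sym side≡w) (proj₂ (inBox 0y))) (≮⇒≥ y≮))

  L : ℕ → ℕ
  L = at (armSequence g)

  L≡ℓ : ∀ i → i < m → L i ≡ ℓ i
  L≡ℓ = at-tabulateℕ m ℓ

  L≤M : ∀ i → i < m → L i ≤ M
  L≤M i i<m = subst (_≤ M) (sym (L≡ℓ i i<m)) (ℓ≤M i)

  L-quasiconcave : Quasiconcave L m
  L-quasiconcave i j k c i≤j j≤k k<m c≤Li c≤Lk = subst (c ≤_) (sym (L≡ℓ j j<m))
    (ℓ-quasiconcave i j k c i≤j j≤k k<m (subst (c ≤_) (L≡ℓ i (≤-<-trans i≤j j<m)) c≤Li)
                                        (subst (c ≤_) (L≡ℓ k k<m) c≤Lk))
    where j<m : j < m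
          j<m = ≤-<-trans j≤k k<m

  L-peak : ∃ λ i → i < m × L i ≡ M
  L-peak with ℓ-peak
  ... | i , i<m , M≤ℓi = i , i<m , ≤-antisym (L≤M i i<m) (subst (M ≤_) (sym (L≡ℓ i i<m)) M≤ℓi)

  vmax≡M : vmax (armSequence g) ≡ M
  vmax≡M with L-peak
  ... | i , i<m , Li≡M = vmax-unique (armSequence g) M L≤M (i , i<m , Li≡M)

  open Cross M m L
    using (inCross; inCross-rotate; inCross-corner; inCross-centre; inCross-leftArm⁻; inCross-leftArm⁺)

  cell≡inCross : ∀ x y → x < M + m + M → y < M + m + M → cell g x y ≡ inCross x y
  cell≡inCross = rotInvariant-agree M m (cell g) inCross rot' inCross-rotate corner leftArm' centre
    where
    rot' : RotInvariant M m (cell g)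
    rot' x y rewrite side≡w = rot x y
    corner : ∀ x y → x < M → y < M → cell g x y ≡ inCross x y
    corner x y x<M y<M = trans (¬-not (corner-empty x y x<M y<M)) (sym (inCross-corner x y x<M y<M))
    leftArm' : ∀ x y → x < M → M ≤ y → y < M + m → cell g x y ≡ inCross x y
    leftArm' x y x<M M≤y y< = subst (λ z → cell g x z ≡ inCross x z) (m+[n∸m]≡n M≤y)
      (≡true-ext
        (λ e → inCross-leftArm⁺ x i x<M i<m (subst (λ z → M ≤ x + z) (sym (L≡ℓ i i<m)) (proj₁ (leftArm x i x<M i<m) e)))
        (λ e → proj₂ (leftArm x i x<M i<m) (subst (λ z → M ≤ x + z) (L≡ℓ i i<m) (inCross-leftArm⁻ x i x<M i<m e))))
      where
      i : ℕ
      i = y ∸ M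
      i<m : i < m
      i<m = offset< M m y M≤y y<
    centre : ∀ x y → M ≤ x → x < M + m → M ≤ y → y < M + m → cell g x y ≡ inCross x y
    centre x y M≤x x< M≤y y< = trans (centre-full x y M≤x x< M≤y y<) (sym (inCross-centre x y M≤x x< M≤y y<))

  unimodal : WeaklyUnimodal (armSequence g)
  unimodal = quasiconcave⇒weaklyUnimodal (armSequence g) L-quasiconcave 1≤m

  halfPerimeter : 2 * m + 4 * vmax (armSequence g) ≡ w + w
  halfPerimeter = begin
    2 * m + 4 * vmax (armSequence g) ≡⟨ cong (λ z → 2 * m + 4 * z) vmax≡M ⟩
    2 * m + 4 * M                    ≡⟨ shuffle M m ⟩
    (M + m + M) + (M + m + M)        ≡⟨ cong₂ _+_ side≡w side≡w ⟩
    w + w                            ∎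
    where open ≡-Reasoning
          shuffle : ∀ M m → 2 * m + 4 * M ≡ M + m + M + (M + m + M)
          shuffle = solve-∀

  area-decomposition : m * m + 4 * sum (armSequence g) ≡ area g
  area-decomposition = begin
    m * m + 4 * sum (armSequence g)                      ≡⟨ cong (λ z → m * m + 4 * z) (sum≡∑at (armSequence g)) ⟩
    m * m + 4 * ∑< m L                                   ≡⟨ sym (CrossPolyomino.∑∑-inCross M m L L≤M) ⟩
    ∑[ x < M + m + M ] ∑[ y < M + m + M ] 𝟙 (inCross x y)
      ≡⟨ ∑-cong _ _ _ (λ x x< → ∑-cong _ _ _ (λ y y< → cong 𝟙 (sym (cell≡inCross x y x< y<)))) ⟩
    ∑[ x < M + m + M ] ∑[ y < M + m + M ] 𝟙 (cell g x y)
      ≡⟨ cong (λ k → ∑[ x < k ] ∑[ y < k ] 𝟙 (cell g x y)) side≡w ⟩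
    ∑[ x < w ] ∑[ y < w ] 𝟙 (cell g x y)                 ≡⟨ sym (area≡∑cells g) ⟩
    area g                                               ∎
    where open ≡-Reasoning

crossGrid : ∀ {m} (s : Vec ℕ m) → Grid (vmax s + m + vmax s) (vmax s + m + vmax s)
crossGrid {m} s = Cross.grid (vmax s) m (at s)

module _ {m} (s : Vec ℕ m) where

  open CrossPolyomino (vmax s) m (at s) (λ i _ → at≤vmax s i)

  crossGrid-tight : 1 ≤ m → TightBox (crossGrid s)
  crossGrid-tight 1≤m with vmax-attained s 1≤m
  ... | i , i<m , peak = grid-tight 1≤m i i<m peak

  crossGrid-connected : 1 ≤ m → EdgeConnected (crossGrid s)
  crossGrid-connected = grid-connected

  crossGrid-convex : WeaklyUnimodal s → Convex (crossGrid s)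
  crossGrid-convex unimodal = grid-convex (weaklyUnimodal⇒quasiconcave s unimodal)

  crossGrid-rot90 : Rot90Invariant (crossGrid s)
  crossGrid-rot90 = refl , grid-rot90

  crossGrid-halfPerimeter : (vmax s + m + vmax s) + (vmax s + m + vmax s) ≡ 2 * m + 4 * vmax s
  crossGrid-halfPerimeter = shuffle (vmax s) m
    where shuffle : ∀ M m → M + m + M + (M + m + M) ≡ 2 * m + 4 * M
          shuffle = solve-∀

  crossGrid-area : area (crossGrid s) ≡ m * m + 4 * sum s
  crossGrid-area = trans area-grid (cong (λ z → m * m + 4 * z) (sym (sum≡∑at s)))

module _ {m} (s : Vec ℕ m) (1≤m : 1 ≤ m) where

  private
    M : ℕ
    M = vmax s
    open Cross M m (at s)
    open CrossPolyomino M m (at s) (λ i _ → at≤vmax s i)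

  diagonalStart-crossGrid : diagonalStart (crossGrid s) ≡ M
  diagonalStart-crossGrid =
    firstTrue-unique side (λ k → cell grid k k) M M<side
      (In-grid⁺ M M (inCross-centre M M ≤-refl M<M+m₁ ≤-refl M<M+m₁))
      (λ j j<M → let j<side = <-trans j<M M<side in
                 trans (cell-tabulateGrid side side inCross j j j<side j<side) (inCross-corner j j j<M j<M))
    where
    M<M+m₁ : M < M + m
    M<M+m₁ = M<M+m 1≤m
    M<side : M < side
    M<side = <-≤-trans M<M+m₁ M+m≤side

  centreSize-crossGrid : centreSize (crossGrid s) ≡ m
  centreSize-crossGrid = begin
    side ∸ (diagonalStart (crossGrid s) + diagonalStart (crossGrid s))
      ≡⟨ cong (λ z → side ∸ (z + z)) diagonalStart-crossGrid ⟩
    M + m + M ∸ (M + M) ≡⟨ cong (_∸ (M + M)) (shuffle M m) ⟩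
    M + M + m ∸ (M + M) ≡⟨ m+n∸m≡n (M + M) m ⟩
    m                   ∎
    where open ≡-Reasoning
          shuffle : ∀ M m → M + m + M ≡ M + M + m
          shuffle = solve-∀

  armLength-crossGrid : ∀ i → i < m → armLength (crossGrid s) i ≡ at s i
  armLength-crossGrid i i<m = begin
    armLength grid i                    ≡⟨ cong (λ X → count X (λ x → cell grid x (X + i))) diagonalStart-crossGrid ⟩
    count M (λ x → cell grid x (M + i)) ≡⟨ ∑-cong M _ _ (λ x x<M → cong 𝟙 (inArm x x<M)) ⟩
    count M (inRange (M ∸ at s i) M)    ≡⟨ count-inRange M (M ∸ at s i) M ≤-refl ⟩
    M ∸ (M ∸ at s i)                    ≡⟨ m∸[m∸n]≡n (at≤vmax s i) ⟩
    at s i                              ∎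
    where
    open ≡-Reasoning
    inArm : ∀ x → x < M → cell grid x (M + i) ≡ inRange (M ∸ at s i) M x
    inArm x x<M = trans (cell-tabulateGrid side side inCross x (M + i) (<-≤-trans (<-≤-trans x<M (m≤m+n M m)) M+m≤side)
                                                              (<-≤-trans (+-monoʳ-< M i<m) M+m≤side))
      (≡true-ext (λ e → inRange⁺ (m≤o+n⇒m∸n≤o M (at s i) x (inCross-leftArm⁻ x i x<M i<m e)) x<M)
                 (λ e → inCross-leftArm⁺ x i x<M i<m (m∸n≤o⇒m≤o+n M (at s i) x (proj₁ (inRange⁻ {hi = M} e)))))

  armSequence-crossGrid : ∀ i → i < m → at (armSequence (crossGrid s)) i ≡ at s i
  armSequence-crossGrid i i<m =
    trans (at-tabulateℕ (centreSize (crossGrid s)) (armLength (crossGrid s)) i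
                        (subst (i <_) (sym centreSize-crossGrid) i<m))
          (armLength-crossGrid i i<m)

module _ {w h} (g : Grid w h) (tight : TightBox g) (connected : EdgeConnected g) (convex : Convex g) where

  centreSize-positive : Rot90Invariant g → 1 ≤ centreSize g
  centreSize-positive (refl , rot) = RotationInvariantConvex.1≤m g rot convex connected tight

  armSequence-weaklyUnimodal : Rot90Invariant g → WeaklyUnimodal (armSequence g)
  armSequence-weaklyUnimodal (refl , rot) = RotationInvariantConvex.unimodal g rot convex connected tight

  armSequence-halfPerimeter : Rot90Invariant g → 2 * centreSize g + 4 * vmax (armSequence g) ≡ w + h
  armSequence-halfPerimeter (refl , rot) = RotationInvariantConvex.halfPerimeter g rot convex connected tight

  armSequence-area : Rot90Invariant g → centreSize g * centreSize g + 4 * sum (armSequence g) ≡ area g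
  armSequence-area (refl , rot) = RotationInvariantConvex.area-decomposition g rot convex connected tight

  crossGrid-armSequence-width : Rot90Invariant g → vmax (armSequence g) + centreSize g + vmax (armSequence g) ≡ w
  crossGrid-armSequence-width (refl , rot) = trans (cong (λ z → z + m + z) vmax≡M) side≡w
    where open RotationInvariantConvex g rot convex connected tight

  crossGrid-armSequence-height : Rot90Invariant g → vmax (armSequence g) + centreSize g + vmax (armSequence g) ≡ h
  crossGrid-armSequence-height r@(refl , _) = crossGrid-armSequence-width r

  cell-crossGrid-armSequence : Rot90Invariant g → ∀ x y → x < w → y < h →
                               cell (crossGrid (armSequence g)) x y ≡ cell g x y
  cell-crossGrid-armSequence (refl , rot) x y x<w y<w = begin
    cell (crossGrid (armSequence g)) x y
      ≡⟨ cell-tabulateGrid _ _ (Cross.inCross (vmax (armSequence g)) m L) x y (<side x<w) (<side y<w) ⟩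
    Cross.inCross (vmax (armSequence g)) m L x y
      ≡⟨ cong (λ z → Cross.inCross z m L x y) vmax≡M ⟩
    Cross.inCross M m L x y
      ≡⟨ sym (cell≡inCross x y (subst (x <_) (sym side≡w) x<w) (subst (y <_) (sym side≡w) y<w)) ⟩
    cell g x y ∎
    where
    open ≡-Reasoning
    open RotationInvariantConvex g rot convex connected tight
    <side : ∀ {z} → z < w → z < vmax (armSequence g) + m + vmax (armSequence g)
    <side z<w = subst (_ <_) (sym (crossGrid-armSequence-width (refl , rot))) z<w

UnimodalTerm-≡ : ∀ {n a} (u v : UnimodalTerm n a) → UnimodalTerm.len u ≡ UnimodalTerm.len v →
  (∀ i → i < UnimodalTerm.len v → at (UnimodalTerm.seq u) i ≡ at (UnimodalTerm.seq v) i) → u ≡ v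
UnimodalTerm-≡ record { seq = s } record { seq = s' } refl s≗s' with at-ext s s' s≗s'
... | refl = refl

RotConvexPoly-≡ : ∀ {n a} (p q : RotConvexPoly n a) →
  RotConvexPoly.width p ≡ RotConvexPoly.width q → RotConvexPoly.height p ≡ RotConvexPoly.height q →
  (∀ x y → x < RotConvexPoly.width q → y < RotConvexPoly.height q →
     cell (RotConvexPoly.grid p) x y ≡ cell (RotConvexPoly.grid q) x y) → p ≡ q
RotConvexPoly-≡ record { grid = g } record { grid = g' } refl refl g≗g' with cell-ext g g' g≗g'
... | refl = refl

toPolyomino : ∀ {n a} → UnimodalTerm n a → RotConvexPoly n a
toPolyomino record { seq = s ; lenPos = 1≤m ; unimodal = unimodal ; tExp = tExp ; qExp = qExp } = record
  { grid      = crossGrid s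
  ; tight     = crossGrid-tight s 1≤m
  ; connected = crossGrid-connected s 1≤m
  ; convex    = crossGrid-convex s unimodal
  ; rotInv    = crossGrid-rot90 s
  ; halfPerim = trans (crossGrid-halfPerimeter s) tExp
  ; areaEq    = trans (crossGrid-area s) qExp
  }

toSequence : ∀ {n a} → RotConvexPoly n a → UnimodalTerm n a
toSequence record { grid = g ; tight = t ; connected = c ; convex = v ; rotInv = r
                  ; halfPerim = hp ; areaEq = ar } = record
  { seq      = armSequence g
  ; lenPos   = centreSize-positive g t c v r
  ; unimodal = armSequence-weaklyUnimodal g t c v r
  ; tExp     = trans (armSequence-halfPerimeter g t c v r) hp
  ; qExp     = trans (armSequence-area g t c v r) ar
  }

-- The proofs stored in the records are irrelevant, so the equations derived from them are
-- recovered by deciding them.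
toSequence-toPolyomino : ∀ {n a} (u : UnimodalTerm n a) → toSequence (toPolyomino u) ≡ u
toSequence-toPolyomino u@record { seq = s ; lenPos = 1≤m } =
  UnimodalTerm-≡ (toSequence (toPolyomino u)) u
    (recompute (_ ≟ _) (centreSize-crossGrid s 1≤m))
    (λ i i<m → recompute (_ ≟ _) (armSequence-crossGrid s 1≤m i i<m))

toPolyomino-toSequence : ∀ {n a} (p : RotConvexPoly n a) → toPolyomino (toSequence p) ≡ p
toPolyomino-toSequence p@record { grid = g ; tight = t ; connected = c ; convex = v ; rotInv = r } =
  RotConvexPoly-≡ (toPolyomino (toSequence p)) p
    (recompute (_ ≟ _) (crossGrid-armSequence-width g t c v r))
    (recompute (_ ≟ _) (crossGrid-armSequence-height g t c v r))
    (λ x y x<w y<h → recompute (_ ≟ᵇ _) (cell-crossGrid-armSequence g t c v r x y x<w y<h))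

mainTheorem9 : ∀ (n a : ℕ) → RotConvexPoly n a ↔ UnimodalTerm n a
mainTheorem9 n a = mk↔ₛ′ toSequence toPolyomino toSequence-toPolyomino toPolyomino-toSequence
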